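{- Let $D=(V,E,\psi)$ be a general $r$-regular digraph with $n$ vertices and $m$ arcs. Then, as an identity of rational functions in $\lambda$, $$A(\lambda , D^{++1}) = \lambda^{m-n} ((\lambda - r)^2 - m n )(\lambda - r)^{ -2} A(\lambda, D)^2.$$
   Context: A general digraph is $D=(V,E,\psi)$ with $V$ finite nonempty, $E$ a finite arc set disjoint from $V$, and $\psi:E\to V\times V$ (loops and multiple arcs allowed); for $\psi(e)=(u,v)$, $t(e)=u$, $h(e)=v$. $D$ is $r$-regular if every vertex is the tail of exactly $r$ arcs and the head of exactly $r$ arcs. The adjacency matrix $A(G)$ has $(u,v)$ entry equal to the number of arcs from $u$ to $v$; $A(\lambda,G)=\det(\lambda I-A(G))$. The line digraph $D^l$ has vertex set $E$ and one arc $(p,q)$ for each ordered pair $p,q\in E$ with $h(p)=t(q)$. $D^{++1}$ is the digraph with vertex set $V\cup E$ whose arcs are the arcs of $D$ (on $V$), the arcs of $D^l$ (on $E$), and all arcs $(v,e)$ and $(e,v)$ for $v\in V$, $e\in E$. -}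

module Defs where

open import Data.Nat as ℕ using (ℕ; zero; suc)
open import Data.Integer as ℤ using (ℤ; +_)
open import Data.List using (List; []; _∷_; map)
open import Data.Fin using (Fin; zero; suc; punchIn; splitAt; _≟_)
open import Data.Sum using (_⊎_; inj₁; inj₂)
open import Data.Bool using (Bool; true; false; if_then_else_)
open import Data.Product using (_×_)
open import Relation.Nullary.Decidable using (⌊_⌋)
open import Relation.Binary.PropositionalEquality using (_≡_)

-- Polynomials over ℤ in one variable λ, as coefficient lists
-- (constant term first).  Equality is coefficientwise (so trailing
-- zeros are irrelevant).

Poly : Set
Poly = List ℤ

infixl 6 _+ᴾ_ _-ᴾ_
infixl 7 _*ᴾ_
infix 4 _≈ᴾ_

_+ᴾ_ : Poly → Poly → Poly
[] +ᴾ q = q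
(a ∷ p) +ᴾ [] = a ∷ p
(a ∷ p) +ᴾ (b ∷ q) = (a ℤ.+ b) ∷ (p +ᴾ q)

-ᴾ_ : Poly → Poly
-ᴾ p = map ℤ.-_ p

_-ᴾ_ : Poly → Poly → Poly
p -ᴾ q = p +ᴾ (-ᴾ q)

_*ᴾ_ : Poly → Poly → Poly
[] *ᴾ q = []
(a ∷ p) *ᴾ q = map (a ℤ.*_) q +ᴾ ((+ 0) ∷ (p *ᴾ q))

constᴾ : ℤ → Poly
constᴾ c = c ∷ []

Xᴾ : Poly
Xᴾ = + 0 ∷ + 1 ∷ []

_^ᴾ_ : Poly → ℕ → Poly
p ^ᴾ zero = constᴾ (+ 1)
p ^ᴾ suc k = p *ᴾ (p ^ᴾ k)

coeff : Poly → ℕ → ℤ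
coeff [] k = + 0
coeff (a ∷ p) zero = a
coeff (a ∷ p) (suc k) = coeff p k

_≈ᴾ_ : Poly → Poly → Set
p ≈ᴾ q = ∀ k → coeff p k ≡ coeff q k

sumᴾ : ∀ {n} → (Fin n → Poly) → Poly
sumᴾ {zero} f = []
sumᴾ {suc n} f = f zero +ᴾ sumᴾ (λ i → f (suc i))

signᴾ : ℕ → Poly
signᴾ zero = constᴾ (+ 1)
signᴾ (suc zero) = constᴾ (ℤ.- (+ 1))
signᴾ (suc (suc k)) = signᴾ k

det : ∀ {n} → (Fin n → Fin n → Poly) → Poly
det {zero} M = constᴾ (+ 1)
det {suc n} M =
  sumᴾ (λ j → signᴾ (Data.Fin.toℕ j) *ᴾ M zero j
               *ᴾ det (λ i k → M (suc i) (punchIn j k)))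

charPoly : ∀ {n} → (Fin n → Fin n → ℕ) → Poly
charPoly M = det (λ i j → (if ⌊ i ≟ j ⌋ then Xᴾ else []) -ᴾ constᴾ (+ M i j))

-- General digraphs: vertices Fin n, arcs Fin m, ψ = (tail, head).
-- Loops and multiple arcs are allowed.

record Digraph (n m : ℕ) : Set where
  field
    tl : Fin m → Fin n
    hd : Fin m → Fin n
open Digraph public

count : ∀ {m} → (Fin m → Bool) → ℕ
count {zero} P = zero
count {suc m} P = (if P zero then 1 else 0) ℕ.+ count (λ i → P (suc i))

Regular : ∀ {n m} → ℕ → Digraph n m → Set
Regular {n} r D = ∀ (v : Fin n) →
  (count (λ e → ⌊ tl D e ≟ v ⌋) ≡ r) × (count (λ e → ⌊ hd D e ≟ v ⌋) ≡ r)

adj : ∀ {n m} → Digraph n m → Fin n → Fin n → ℕ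
adj D u v = count (λ e → if ⌊ tl D e ≟ u ⌋ then ⌊ hd D e ≟ v ⌋ else false)

lineAdj : ∀ {n m} → Digraph n m → Fin m → Fin m → ℕ
lineAdj D p q = if ⌊ hd D p ≟ tl D q ⌋ then 1 else 0

-- adjacency matrix of D^{++1}, vertex set V ⊎ E encoded as Fin (n + m)
-- (first n indices = V, last m indices = E)
plusAdj' : ∀ {n m} → Digraph n m → Fin n ⊎ Fin m → Fin n ⊎ Fin m → ℕ
plusAdj' D (inj₁ u) (inj₁ v) = adj D u v
plusAdj' D (inj₂ p) (inj₂ q) = lineAdj D p q
plusAdj' D (inj₁ u) (inj₂ q) = 1
plusAdj' D (inj₂ p) (inj₁ v) = 1

plusAdj : ∀ {n m} → Digraph n m → Fin (n ℕ.+ m) → Fin (n ℕ.+ m) → ℕ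
plusAdj {n} D x y = plusAdj' D (splitAt n x) (splitAt n y)

module Submission where

-- Write c = λ − r and let T (n×m) and H (m×n) be the tail and head
-- incidence matrices of D, so that A(D) = TH and A(Dˡ) = HT.  Ordering the
-- vertices of D⁺⁺¹ as V then E, λI − A(D⁺⁺¹) = [[λI − TH, −J], [−J, λI − HT]].
-- Since every in-degree is r, every column of λI − TH and of λI − HT sums
-- to c, and row operations give  c² det(λI − A(D⁺⁺¹)) = (c² − nm) A(λ,D)
-- det(λI − HT)  (module BorderedBlock).  Sylvester's identity
-- λⁿ det(λI − HT) = λᵐ det(λI − TH) (module Sylvester) then yields the
-- theorem, in the division-free form  λⁿ c² A(λ, D⁺⁺¹) = λᵐ (c² − mn) A(λ, D)².

open import Defs
open import Data.Nat using (ℕ; _≤_; _*_)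
open import Data.Integer using (+_)

open import Data.Nat as ℕ using (zero; suc; s≤s)
import Data.Nat.Properties as ℕP
open import Data.Integer as ℤ using (ℤ; -[1+_])
import Data.Integer.Properties as ℤP
import Data.Integer.Tactic.RingSolver as ℤSolver
open import Data.List using ([]; _∷_; map)
open import Data.Fin as F using (Fin; zero; suc; punchIn; punchOut; toℕ; fromℕ<; _↑ˡ_; _↑ʳ_; splitAt)
import Data.Fin.Properties as FP
open import Data.Bool using (Bool; true; false; if_then_else_)
open import Data.Maybe using (Maybe; just; nothing)
open import Data.Product using (_×_; _,_; proj₁; proj₂)
open import Data.Sum using (_⊎_; inj₁; inj₂)
open import Data.Empty using (⊥-elim)
open import Level using (0ℓ)
open import Relation.Nullary using (¬_; Dec; yes; no)
open import Relation.Nullary.Decidable using (⌊_⌋)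
open import Relation.Binary.PropositionalEquality as Eq using (_≡_; _≢_; refl; cong; cong₂)
open import Algebra.Bundles using (CommutativeRing)
open import Tactic.RingSolver.Core.AlmostCommutativeRing using (AlmostCommutativeRing; fromCommutativeRing)
open import Tactic.RingSolver using (solve-∀)
import Relation.Binary.Reasoning.Setoid as SetoidReasoning

-- Equality is coefficientwise;
-- it is wrapped in a record so that the two polynomials can be inferred
-- from the type of an equality proof (the bare function type ∀ k → …
-- cannot be inverted by unification), which keeps the implicit arguments
-- of the lemmas below inferable.

infix 4 _≈_
record _≈_ (p q : Poly) : Set where
  constructor mk
  field get : p ≈ᴾ q
open _≈_ public

0ᴾ 1ᴾ : Poly
0ᴾ = []
1ᴾ = constᴾ (+ 1)

scale : ℤ → Poly → Poly
scale a = map (a ℤ.*_)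

coeff-+ : ∀ p q k → coeff (p +ᴾ q) k ≡ coeff p k ℤ.+ coeff q k
coeff-+ [] q k = Eq.sym (ℤP.+-identityˡ _)
coeff-+ (a ∷ p) [] k = Eq.sym (ℤP.+-identityʳ _)
coeff-+ (a ∷ p) (b ∷ q) zero = refl
coeff-+ (a ∷ p) (b ∷ q) (suc k) = coeff-+ p q k

coeff-scale : ∀ a q k → coeff (scale a q) k ≡ a ℤ.* coeff q k
coeff-scale a [] k = Eq.sym (ℤP.*-zeroʳ a)
coeff-scale a (b ∷ q) zero = refl
coeff-scale a (b ∷ q) (suc k) = coeff-scale a q k

coeff-neg : ∀ q k → coeff (-ᴾ q) k ≡ ℤ.- coeff q k
coeff-neg [] k = refl
coeff-neg (b ∷ q) zero = refl
coeff-neg (b ∷ q) (suc k) = coeff-neg q k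

≈-refl : ∀ {p} → p ≈ p
≈-refl = mk λ k → refl

≈-sym : ∀ {p q} → p ≈ q → q ≈ p
≈-sym (mk e) = mk λ k → Eq.sym (e k)

≈-trans : ∀ {p q r} → p ≈ q → q ≈ r → p ≈ r
≈-trans (mk e) (mk f) = mk λ k → Eq.trans (e k) (f k)

≡⇒≈ : ∀ {p q} → p ≡ q → p ≈ q
≡⇒≈ refl = ≈-refl

cons-cong : ∀ {a b p q} → a ≡ b → p ≈ q → (a ∷ p) ≈ (b ∷ q)
cons-cong e (mk f) = mk λ { zero → e ; (suc k) → f k }

const-0 : constᴾ (+ 0) ≈ 0ᴾ
const-0 = mk λ { zero → refl ; (suc k) → refl }

+-cong : ∀ {p p' q q'} → p ≈ p' → q ≈ q' → p +ᴾ q ≈ p' +ᴾ q'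
+-cong {p} {p'} {q} {q'} (mk e) (mk f) = mk λ k → begin
    coeff (p +ᴾ q) k          ≡⟨ coeff-+ p q k ⟩
    coeff p k ℤ.+ coeff q k    ≡⟨ cong₂ ℤ._+_ (e k) (f k) ⟩
    coeff p' k ℤ.+ coeff q' k  ≡⟨ Eq.sym (coeff-+ p' q' k) ⟩
    coeff (p' +ᴾ q') k        ∎
  where open Eq.≡-Reasoning

+-comm : ∀ p q → p +ᴾ q ≈ q +ᴾ p
+-comm p q = mk λ k → Eq.trans (coeff-+ p q k)
  (Eq.trans (ℤP.+-comm (coeff p k) (coeff q k)) (Eq.sym (coeff-+ q p k)))

+-assoc : ∀ p q r → (p +ᴾ q) +ᴾ r ≈ p +ᴾ (q +ᴾ r)
+-assoc p q r = mk coeffwise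
  where
  coeffwise : ∀ k → coeff ((p +ᴾ q) +ᴾ r) k ≡ coeff (p +ᴾ (q +ᴾ r)) k
  coeffwise k rewrite coeff-+ (p +ᴾ q) r k | coeff-+ p q k | coeff-+ p (q +ᴾ r) k | coeff-+ q r k =
    ℤP.+-assoc (coeff p k) (coeff q k) (coeff r k)

+-interchange : ∀ w x y z → (w +ᴾ x) +ᴾ (y +ᴾ z) ≈ (w +ᴾ y) +ᴾ (x +ᴾ z)
+-interchange w x y z = mk coeffwise
  where
  interchangeℤ : ∀ (w x y z : ℤ) → (w ℤ.+ x) ℤ.+ (y ℤ.+ z) ≡ (w ℤ.+ y) ℤ.+ (x ℤ.+ z)
  interchangeℤ = ℤSolver.solve-∀
  coeffwise : ∀ k → coeff ((w +ᴾ x) +ᴾ (y +ᴾ z)) k ≡ coeff ((w +ᴾ y) +ᴾ (x +ᴾ z)) k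
  coeffwise k rewrite coeff-+ (w +ᴾ x) (y +ᴾ z) k | coeff-+ w x k | coeff-+ y z k
    | coeff-+ (w +ᴾ y) (x +ᴾ z) k | coeff-+ w y k | coeff-+ x z k =
    interchangeℤ (coeff w k) (coeff x k) (coeff y k) (coeff z k)

+-identityʳ : ∀ p → p +ᴾ 0ᴾ ≈ p
+-identityʳ [] = ≈-refl
+-identityʳ (a ∷ p) = ≈-refl

neg-cong : ∀ {p q} → p ≈ q → -ᴾ p ≈ -ᴾ q
neg-cong {p} {q} (mk e) = mk λ k →
  Eq.trans (coeff-neg p k) (Eq.trans (cong ℤ.-_ (e k)) (Eq.sym (coeff-neg q k)))

+-inverseˡ : ∀ p → (-ᴾ p) +ᴾ p ≈ 0ᴾ
+-inverseˡ p = mk λ k → Eq.trans (coeff-+ (-ᴾ p) p k)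
  (Eq.trans (cong (ℤ._+ coeff p k) (coeff-neg p k)) (ℤP.+-inverseˡ (coeff p k)))

+-inverseʳ : ∀ p → p +ᴾ (-ᴾ p) ≈ 0ᴾ
+-inverseʳ p = mk λ k → Eq.trans (coeff-+ p (-ᴾ p) k)
  (Eq.trans (cong (λ z → coeff p k ℤ.+ z) (coeff-neg p k)) (ℤP.+-inverseʳ (coeff p k)))

scale-cong : ∀ a {p q} → p ≈ q → scale a p ≈ scale a q
scale-cong a {p} {q} (mk e) = mk λ k →
  Eq.trans (coeff-scale a p k) (Eq.trans (cong (a ℤ.*_) (e k)) (Eq.sym (coeff-scale a q k)))

scale-eq : ∀ {a b} p → a ≡ b → scale a p ≈ scale b p
scale-eq p refl = ≈-refl

scale-+ʳ : ∀ a p q → scale a (p +ᴾ q) ≈ scale a p +ᴾ scale a q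
scale-+ʳ a p q = mk coeffwise
  where
  coeffwise : ∀ k → coeff (scale a (p +ᴾ q)) k ≡ coeff (scale a p +ᴾ scale a q) k
  coeffwise k rewrite coeff-scale a (p +ᴾ q) k | coeff-+ (scale a p) (scale a q) k
    | coeff-+ p q k | coeff-scale a p k | coeff-scale a q k = ℤP.*-distribˡ-+ a _ _

scale-+ˡ : ∀ a b p → scale (a ℤ.+ b) p ≈ scale a p +ᴾ scale b p
scale-+ˡ a b p = mk coeffwise
  where
  coeffwise : ∀ k → coeff (scale (a ℤ.+ b) p) k ≡ coeff (scale a p +ᴾ scale b p) k
  coeffwise k rewrite coeff-scale (a ℤ.+ b) p k | coeff-+ (scale a p) (scale b p) k
    | coeff-scale a p k | coeff-scale b p k = ℤP.*-distribʳ-+ _ a b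

scale-scale : ∀ a b p → scale a (scale b p) ≈ scale (a ℤ.* b) p
scale-scale a b p = mk coeffwise
  where
  coeffwise : ∀ k → coeff (scale a (scale b p)) k ≡ coeff (scale (a ℤ.* b) p) k
  coeffwise k rewrite coeff-scale a (scale b p) k | coeff-scale b p k | coeff-scale (a ℤ.* b) p k =
    Eq.sym (ℤP.*-assoc a b _)

scale-0 : ∀ p → scale (+ 0) p ≈ 0ᴾ
scale-0 p = mk λ k → coeff-scale (+ 0) p k

scale-1 : ∀ p → scale (+ 1) p ≈ p
scale-1 p = mk λ k → Eq.trans (coeff-scale (+ 1) p k) (ℤP.*-identityˡ _)

zero-mul : ∀ {p} q → p ≈ 0ᴾ → p *ᴾ q ≈ 0ᴾ
zero-mul {[]} q e = ≈-refl
zero-mul {a ∷ p} q (mk e) =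
  ≈-trans (+-cong (≈-trans (scale-eq q (e zero)) (scale-0 q))
                  (cons-cong refl (zero-mul q (mk {p} {[]} λ k → e (suc k)))))
          const-0

*-congˡ : ∀ {p p'} q → p ≈ p' → p *ᴾ q ≈ p' *ᴾ q
*-congˡ {[]} q e = ≈-sym (zero-mul q (≈-sym e))
*-congˡ {a ∷ p} {[]} q e = zero-mul q e
*-congˡ {a ∷ p} {b ∷ p'} q (mk e) =
  +-cong (scale-eq q (e zero)) (cons-cong refl (*-congˡ q (mk {p} {p'} λ k → e (suc k))))

*-congʳ : ∀ p {q q'} → q ≈ q' → p *ᴾ q ≈ p *ᴾ q'
*-congʳ [] e = ≈-refl
*-congʳ (a ∷ p) e = +-cong (scale-cong a e) (cons-cong refl (*-congʳ p e))

*-cong : ∀ {p p' q q'} → p ≈ p' → q ≈ q' → p *ᴾ q ≈ p' *ᴾ q'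
*-cong {p' = p'} {q = q} e f = ≈-trans (*-congˡ q e) (*-congʳ p' f)

*-zeroʳ : ∀ p → p *ᴾ 0ᴾ ≈ 0ᴾ
*-zeroʳ [] = ≈-refl
*-zeroʳ (a ∷ p) = ≈-trans (cons-cong refl (*-zeroʳ p)) const-0

mul-zero : ∀ p {q} → q ≈ 0ᴾ → p *ᴾ q ≈ 0ᴾ
mul-zero p e = ≈-trans (*-congʳ p e) (*-zeroʳ p)

scale-mulˡ : ∀ a p q → scale a p *ᴾ q ≈ scale a (p *ᴾ q)
scale-mulˡ a [] q = ≈-refl
scale-mulˡ a (b ∷ p) q =
  ≈-trans (+-cong (≈-sym (scale-scale a b q)) (cons-cong (Eq.sym (ℤP.*-zeroʳ a)) (scale-mulˡ a p q)))
          (≈-sym (scale-+ʳ a (scale b q) (+ 0 ∷ (p *ᴾ q))))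

mul-shiftʳ : ∀ p q → p *ᴾ (+ 0 ∷ q) ≈ + 0 ∷ (p *ᴾ q)
mul-shiftʳ [] q = ≈-sym const-0
mul-shiftʳ (b ∷ p) q =
  ≈-trans (+-cong (≈-refl {b ℤ.* + 0 ∷ scale b q}) (cons-cong refl (mul-shiftʳ p q)))
          (cons-cong (Eq.trans (ℤP.+-identityʳ _) (ℤP.*-zeroʳ b)) ≈-refl)

mul-shiftˡ : ∀ p q → (+ 0 ∷ p) *ᴾ q ≈ + 0 ∷ (p *ᴾ q)
mul-shiftˡ p q = +-cong (scale-0 q) ≈-refl

const-mul : ∀ b q → constᴾ b *ᴾ q ≈ scale b q
const-mul b q = ≈-trans (+-cong (≈-refl {scale b q}) const-0) (+-identityʳ _)

mul-const : ∀ p b → p *ᴾ constᴾ b ≈ scale b p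
mul-const [] b = ≈-refl
mul-const (a ∷ p) b =
  ≈-trans (mk λ { zero → ℤP.+-identityʳ _ ; (suc k) → refl }) (cons-cong (ℤP.*-comm a b) (mul-const p b))

*-distribʳ : ∀ p q r → (p +ᴾ q) *ᴾ r ≈ p *ᴾ r +ᴾ q *ᴾ r
*-distribʳ [] q r = ≈-refl
*-distribʳ (a ∷ p) [] r = ≈-sym (+-identityʳ _)
*-distribʳ (a ∷ p) (b ∷ q) r =
  ≈-trans (+-cong (scale-+ˡ a b r) (cons-cong (Eq.sym (ℤP.+-identityʳ (+ 0))) (*-distribʳ p q r)))
          (+-interchange (scale a r) (scale b r) (+ 0 ∷ (p *ᴾ r)) (+ 0 ∷ (q *ᴾ r)))

*-distribˡ : ∀ p q r → p *ᴾ (q +ᴾ r) ≈ p *ᴾ q +ᴾ p *ᴾ r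
*-distribˡ [] q r = ≈-refl
*-distribˡ (a ∷ p) q r =
  ≈-trans (+-cong (scale-+ʳ a q r) (cons-cong (Eq.sym (ℤP.+-identityʳ (+ 0))) (*-distribˡ p q r)))
          (+-interchange (scale a q) (scale a r) (+ 0 ∷ (p *ᴾ q)) (+ 0 ∷ (p *ᴾ r)))

mul-consʳ : ∀ p b q → p *ᴾ (b ∷ q) ≈ scale b p +ᴾ (+ 0 ∷ (p *ᴾ q))
mul-consʳ p b q = ≈-trans (*-congʳ p split) (≈-trans (*-distribˡ p (constᴾ b) (+ 0 ∷ q))
                                                      (+-cong (mul-const p b) (mul-shiftʳ p q)))
  where
  split : (b ∷ q) ≈ constᴾ b +ᴾ (+ 0 ∷ q)
  split = mk λ { zero → Eq.sym (ℤP.+-identityʳ b) ; (suc k) → refl }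

*-comm : ∀ p q → p *ᴾ q ≈ q *ᴾ p
*-comm [] q = ≈-sym (*-zeroʳ q)
*-comm (a ∷ p) q = ≈-sym (≈-trans (mul-consʳ q a p) (+-cong ≈-refl (cons-cong refl (*-comm q p))))

*-assoc : ∀ p q r → (p *ᴾ q) *ᴾ r ≈ p *ᴾ (q *ᴾ r)
*-assoc [] q r = ≈-refl
*-assoc (a ∷ p) q r =
  ≈-trans (*-distribʳ (scale a q) (+ 0 ∷ (p *ᴾ q)) r)
          (+-cong (scale-mulˡ a q r) (≈-trans (mul-shiftˡ (p *ᴾ q) r) (cons-cong refl (*-assoc p q r))))

*-identityˡ : ∀ p → 1ᴾ *ᴾ p ≈ p
*-identityˡ p = ≈-trans (const-mul (+ 1) p) (scale-1 p)

*-identityʳ : ∀ p → p *ᴾ 1ᴾ ≈ p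
*-identityʳ p = ≈-trans (*-comm p _) (*-identityˡ p)

ℤ[λ] : CommutativeRing 0ℓ 0ℓ
ℤ[λ] = record
  { Carrier = Poly ; _≈_ = _≈_ ; _+_ = _+ᴾ_ ; _*_ = _*ᴾ_ ; -_ = -ᴾ_ ; 0# = 0ᴾ ; 1# = 1ᴾ
  ; isCommutativeRing = record
    { isRing = record
      { +-isAbelianGroup = record
        { isGroup = record
          { isMonoid = record
            { isSemigroup = record
              { isMagma = record
                { isEquivalence = record { refl = ≈-refl ; sym = ≈-sym ; trans = ≈-trans }
                ; ∙-cong = +-cong }
              ; assoc = +-assoc }
            ; identity = (λ p → ≈-refl) , +-identityʳ }
          ; inverse = +-inverseˡ , +-inverseʳ
          ; ⁻¹-cong = neg-cong }
        ; comm = +-comm }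
      ; *-cong = *-cong
      ; *-assoc = *-assoc
      ; *-identity = *-identityˡ , *-identityʳ
      ; distrib = *-distribˡ , (λ r p q → *-distribʳ p q r) }
    ; *-comm = *-comm } }

-- the ring solver needs a (partial) zero test on the carrier
isZero : ∀ p → Maybe (0ᴾ ≈ p)
isZero [] = just ≈-refl
isZero (+ zero ∷ p) with isZero p
... | just (mk e) = just (mk λ { zero → refl ; (suc k) → e k })
... | nothing = nothing
isZero (_ ∷ p) = nothing

ℤ[λ]-solver : AlmostCommutativeRing 0ℓ 0ℓ
ℤ[λ]-solver = fromCommutativeRing ℤ[λ] isZero

module ≈-Reasoning = SetoidReasoning (CommutativeRing.setoid ℤ[λ])

-- λ − r is not a zero divisor.  Writing the product (λ − r)·d out
-- coefficientwise, a + (λ − r)·d = 0 forces, from the top coefficient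
-- down, d = 0 and a = 0.

linearFactor : ℕ → Poly
linearFactor r = Xᴾ -ᴾ constᴾ (+ r)

linearFactor-mul : ∀ r p → linearFactor r *ᴾ p ≈ scale (ℤ.- (+ r)) p +ᴾ (+ 0 ∷ p)
linearFactor-mul r p = +-cong (scale-eq p (ℤP.+-identityˡ (ℤ.- (+ r)))) (cons-cong refl (*-identityˡ p))

affine : ℕ → ℤ → Poly → Poly
affine r a d = constᴾ a +ᴾ (scale (ℤ.- (+ r)) d +ᴾ (+ 0 ∷ d))

coeff-affine-0 : ∀ r a d → coeff (affine r a d) 0 ≡ a ℤ.+ (ℤ.- (+ r) ℤ.* coeff d 0 ℤ.+ + 0)
coeff-affine-0 r a d = Eq.trans (coeff-+ (constᴾ a) (scale (ℤ.- (+ r)) d +ᴾ (+ 0 ∷ d)) 0)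
  (cong (λ z → a ℤ.+ z) (Eq.trans (coeff-+ (scale (ℤ.- (+ r)) d) (+ 0 ∷ d) 0)
                           (cong (ℤ._+ + 0) (coeff-scale (ℤ.- (+ r)) d 0))))

coeff-affine-suc : ∀ r a d k → coeff (affine r a d) (suc k) ≡ ℤ.- (+ r) ℤ.* coeff d (suc k) ℤ.+ coeff d k
coeff-affine-suc r a d k = Eq.trans (coeff-+ (constᴾ a) (scale (ℤ.- (+ r)) d +ᴾ (+ 0 ∷ d)) (suc k)) (Eq.trans (ℤP.+-identityˡ _)
  (Eq.trans (coeff-+ (scale (ℤ.- (+ r)) d) (+ 0 ∷ d) (suc k))
            (cong (ℤ._+ coeff d k) (coeff-scale (ℤ.- (+ r)) d (suc k)))))

coeff-affine-cons : ∀ r a b d k → coeff (affine r a (b ∷ d)) (suc k) ≡ coeff (affine r b d) k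
coeff-affine-cons r a b d zero = begin
    coeff (affine r a (b ∷ d)) 1           ≡⟨ coeff-affine-suc r a (b ∷ d) 0 ⟩
    ℤ.- (+ r) ℤ.* coeff d 0 ℤ.+ b          ≡⟨ ℤP.+-comm _ b ⟩
    b ℤ.+ ℤ.- (+ r) ℤ.* coeff d 0          ≡⟨ cong (λ z → b ℤ.+ z) (Eq.sym (ℤP.+-identityʳ _)) ⟩
    b ℤ.+ (ℤ.- (+ r) ℤ.* coeff d 0 ℤ.+ + 0) ≡⟨ Eq.sym (coeff-affine-0 r b d) ⟩
    coeff (affine r b d) 0                 ∎
  where open Eq.≡-Reasoning
coeff-affine-cons r a b d (suc k) = Eq.trans (coeff-affine-suc r a (b ∷ d) (suc k)) (Eq.sym (coeff-affine-suc r b d k))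

coeff-affine-0-of : ∀ r a d → coeff d 0 ≡ + 0 → coeff (affine r a d) 0 ≡ a
coeff-affine-0-of r a d d₀≡0 = begin
  coeff (affine r a d) 0                ≡⟨ coeff-affine-0 r a d ⟩
  a ℤ.+ (ℤ.- (+ r) ℤ.* coeff d 0 ℤ.+ + 0) ≡⟨ cong (λ z → a ℤ.+ (ℤ.- (+ r) ℤ.* z ℤ.+ + 0)) d₀≡0 ⟩
  a ℤ.+ (ℤ.- (+ r) ℤ.* + 0 ℤ.+ + 0)      ≡⟨ cong (λ z → a ℤ.+ (z ℤ.+ + 0)) (ℤP.*-zeroʳ (ℤ.- (+ r))) ⟩
  a ℤ.+ + 0                              ≡⟨ ℤP.+-identityʳ a ⟩
  a                                      ∎
  where open Eq.≡-Reasoning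

affine-zero : ∀ r d a → affine r a d ≈ 0ᴾ → (a ≡ + 0) × (d ≈ 0ᴾ)
affine-zero r [] a (mk h) = Eq.trans (Eq.sym (coeff-affine-0-of r a [] refl)) (h 0) , ≈-refl
affine-zero r (b ∷ d) a (mk h) =
  Eq.trans (Eq.sym (coeff-affine-0-of r a (b ∷ d) b≡0)) (h 0) , ≈-trans (cons-cong b≡0 d≈0) const-0
  where
  tail-zero : affine r b d ≈ 0ᴾ
  tail-zero = mk λ k → Eq.trans (Eq.sym (coeff-affine-cons r a b d k)) (h (suc k))
  b≡0 : b ≡ + 0
  b≡0 = proj₁ (affine-zero r d b tail-zero)
  d≈0 : d ≈ 0ᴾ
  d≈0 = proj₂ (affine-zero r d b tail-zero)

linearFactor-cancel : ∀ r p q → linearFactor r *ᴾ p ≈ linearFactor r *ᴾ q → p ≈ q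
linearFactor-cancel r p q e = ≈-trans (≈-sym (sub-add p q)) (+-cong p-q≈0 ≈-refl)
  where
  mul-sub : ∀ x p q → x *ᴾ (p -ᴾ q) ≈ x *ᴾ p -ᴾ x *ᴾ q
  mul-sub = solve-∀ ℤ[λ]-solver
  sub-add : ∀ p q → (p -ᴾ q) +ᴾ q ≈ p
  sub-add = solve-∀ ℤ[λ]-solver
  product-zero : linearFactor r *ᴾ (p -ᴾ q) ≈ 0ᴾ
  product-zero = ≈-trans (mul-sub (linearFactor r) p q)
                         (≈-trans (+-cong e ≈-refl) (+-inverseʳ (linearFactor r *ᴾ q)))
  p-q≈0 : p -ᴾ q ≈ 0ᴾ
  p-q≈0 = proj₂ (affine-zero r (p -ᴾ q) (+ 0)
            (≈-trans (+-cong const-0 (≈-sym (linearFactor-mul r (p -ᴾ q)))) product-zero))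

linearFactor-pow-cancel : ∀ r k p q → (linearFactor r ^ᴾ k) *ᴾ p ≈ (linearFactor r ^ᴾ k) *ᴾ q → p ≈ q
linearFactor-pow-cancel r zero p q e = ≈-trans (≈-sym (*-identityˡ p)) (≈-trans e (*-identityˡ q))
linearFactor-pow-cancel r (suc k) p q e = linearFactor-pow-cancel r k p q
  (linearFactor-cancel r (linearFactor r ^ᴾ k *ᴾ p) (linearFactor r ^ᴾ k *ᴾ q)
    (≈-trans (≈-sym (*-assoc (linearFactor r) (linearFactor r ^ᴾ k) p))
             (≈-trans e (*-assoc (linearFactor r) (linearFactor r ^ᴾ k) q))))

const-* : ∀ a b → constᴾ (+ (a ℕ.* b)) ≈ constᴾ (+ a) *ᴾ constᴾ (+ b)
const-* a b = ≈-sym (≈-trans (const-mul (+ a) (constᴾ (+ b))) (cons-cong (Eq.sym (ℤP.pos-* a b)) ≈-refl))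

ind : Bool → Poly
ind b = if b then 1ᴾ else 0ᴾ

const-ind : ∀ b → constᴾ (+ (if b then 1 else 0)) ≈ ind b
const-ind true = ≈-refl
const-ind false = const-0

ind-and : ∀ b₁ b₂ → ind (if b₁ then b₂ else false) ≈ ind b₁ *ᴾ ind b₂
ind-and true b₂ = ≈-sym (*-identityˡ (ind b₂))
ind-and false b₂ = ≈-refl

sum-cong : ∀ {N} {f g : Fin N → Poly} → (∀ i → f i ≈ g i) → sumᴾ f ≈ sumᴾ g
sum-cong {zero} e = ≈-refl
sum-cong {suc N} e = +-cong (e zero) (sum-cong (λ i → e (suc i)))

sum-zero : ∀ {N} {f : Fin N → Poly} → (∀ i → f i ≈ 0ᴾ) → sumᴾ f ≈ 0ᴾ
sum-zero {zero} e = ≈-refl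
sum-zero {suc N} e = +-cong (e zero) (sum-zero (λ i → e (suc i)))

sum-+ : ∀ {N} (f g : Fin N → Poly) → sumᴾ (λ i → f i +ᴾ g i) ≈ sumᴾ f +ᴾ sumᴾ g
sum-+ {zero} f g = ≈-refl
sum-+ {suc N} f g = ≈-trans (+-cong ≈-refl (sum-+ (λ i → f (suc i)) (λ i → g (suc i))))
                            (+-interchange (f zero) (g zero) _ _)

sum-*ˡ : ∀ {N} c (f : Fin N → Poly) → c *ᴾ sumᴾ f ≈ sumᴾ (λ i → c *ᴾ f i)
sum-*ˡ {zero} c f = *-zeroʳ c
sum-*ˡ {suc N} c f = ≈-trans (*-distribˡ c (f zero) _) (+-cong ≈-refl (sum-*ˡ c (λ i → f (suc i))))

sum-*ʳ : ∀ {N} c (f : Fin N → Poly) → sumᴾ f *ᴾ c ≈ sumᴾ (λ i → f i *ᴾ c)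
sum-*ʳ c f = ≈-trans (*-comm _ c) (≈-trans (sum-*ˡ c f) (sum-cong (λ i → *-comm c (f i))))

sum-neg : ∀ {N} (f : Fin N → Poly) → -ᴾ sumᴾ f ≈ sumᴾ (λ i → -ᴾ f i)
sum-neg {zero} f = ≈-refl
sum-neg {suc N} f = ≈-trans (neg-+ (f zero) _) (+-cong ≈-refl (sum-neg (λ i → f (suc i))))
  where
  neg-+ : ∀ a b → -ᴾ (a +ᴾ b) ≈ (-ᴾ a) +ᴾ (-ᴾ b)
  neg-+ = solve-∀ ℤ[λ]-solver

sum-swap : ∀ {N K} (f : Fin N → Fin K → Poly) →
  sumᴾ (λ i → sumᴾ (λ j → f i j)) ≈ sumᴾ (λ j → sumᴾ (λ i → f i j))
sum-swap {zero} {K} f = ≈-sym (sum-zero {K} (λ j → ≈-refl))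
sum-swap {suc N} f = ≈-trans (+-cong ≈-refl (sum-swap (λ i j → f (suc i) j)))
                             (≈-sym (sum-+ (λ j → f zero j) (λ j → sumᴾ (λ i → f (suc i) j))))

sum-split : ∀ n {m} (f : Fin (n ℕ.+ m) → Poly) →
  sumᴾ f ≈ sumᴾ (λ i → f (i ↑ˡ m)) +ᴾ sumᴾ (λ j → f (n ↑ʳ j))
sum-split zero f = ≈-refl
sum-split (suc n) {m} f = ≈-trans (+-cong ≈-refl (sum-split n (λ i → f (suc i))))
  (≈-sym (+-assoc (f zero) (sumᴾ (λ i → f (suc (i ↑ˡ m)))) (sumᴾ (λ j → f (suc (n ↑ʳ j))))))

sum-punchIn : ∀ {K} (h : Fin (suc K) → Poly) (j : Fin (suc K)) →
  sumᴾ (λ k → h (punchIn j k)) +ᴾ h j ≈ sumᴾ h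
sum-punchIn h zero = +-comm _ (h zero)
sum-punchIn {suc K} h (suc j) =
  ≈-trans (+-assoc (h zero) (sumᴾ (λ k → h (suc (punchIn j k)))) (h (suc j)))
          (+-cong (≈-refl {h zero}) (sum-punchIn (λ k → h (suc k)) j))

sum-const : ∀ N c → sumᴾ {N} (λ _ → c) ≈ constᴾ (+ N) *ᴾ c
sum-const zero c = ≈-sym (*-congˡ c const-0)
sum-const (suc N) c = ≈-trans (+-cong (≈-sym (*-identityˡ c)) (sum-const N c))
  (≈-sym (*-distribʳ 1ᴾ (constᴾ (+ N)) c))

count-sum : ∀ {m} (P : Fin m → Bool) → constᴾ (+ count P) ≈ sumᴾ (λ e → ind (P e))
count-sum {zero} P = const-0
count-sum {suc m} P = +-cong (const-ind (P zero)) (count-sum (λ i → P (suc i)))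

prodᴾ : ∀ {N} → (Fin N → Poly) → Poly
prodᴾ {zero} c = 1ᴾ
prodᴾ {suc N} c = c zero *ᴾ prodᴾ (λ i → c (suc i))

prod-cong : ∀ {N} {f g : Fin N → Poly} → (∀ i → f i ≈ g i) → prodᴾ f ≈ prodᴾ g
prod-cong {zero} e = ≈-refl
prod-cong {suc N} e = *-cong (e zero) (prod-cong (λ i → e (suc i)))

prod-split : ∀ n {m} (f : Fin (n ℕ.+ m) → Poly) →
  prodᴾ f ≈ prodᴾ (λ i → f (i ↑ˡ m)) *ᴾ prodᴾ (λ j → f (n ↑ʳ j))
prod-split zero f = ≈-sym (*-identityˡ _)
prod-split (suc n) {m} f = ≈-trans (*-congʳ (f zero) (prod-split n (λ i → f (suc i))))
  (≈-sym (*-assoc (f zero) (prodᴾ (λ i → f (suc (i ↑ˡ m)))) (prodᴾ (λ j → f (suc (n ↑ʳ j))))))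

prod-const : ∀ n c → prodᴾ {n} (λ _ → c) ≈ c ^ᴾ n
prod-const zero c = ≈-refl
prod-const (suc n) c = *-congʳ c (prod-const n c)

prod-one : ∀ n → prodᴾ {n} (λ _ → 1ᴾ) ≈ 1ᴾ
prod-one zero = ≈-refl
prod-one (suc n) = ≈-trans (*-congʳ 1ᴾ (prod-one n)) (*-identityˡ 1ᴾ)

prod-split-const : ∀ n m c (f : Fin (n ℕ.+ m) → Poly) →
  (∀ i → f (i ↑ˡ m) ≈ c) → (∀ j → f (n ↑ʳ j) ≈ 1ᴾ) → prodᴾ f ≈ c ^ᴾ n
prod-split-const n m c f eˡ eʳ =
  ≈-trans (prod-split n f) (≈-trans (*-cong (≈-trans (prod-cong eˡ) (prod-const n c))
                                            (≈-trans (prod-cong eʳ) (prod-one m)))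
                                    (*-identityʳ (c ^ᴾ n)))

δ : ∀ {N} → Fin N → Fin N → Poly → Poly
δ i j x = if ⌊ i F.≟ j ⌋ then x else 0ᴾ

δ-same : ∀ {N} (i : Fin N) x → δ i i x ≡ x
δ-same i x with i F.≟ i
... | yes _ = refl
... | no i≢i = ⊥-elim (i≢i refl)

δ-diff : ∀ {N} {i j : Fin N} x → i ≢ j → δ i j x ≡ 0ᴾ
δ-diff {i = i} {j} x i≢j with i F.≟ j
... | yes i≡j = ⊥-elim (i≢j i≡j)
... | no _ = refl

δ-suc : ∀ {N} (i j : Fin N) x → δ (suc i) (suc j) x ≡ δ i j x
δ-suc i j x with i F.≟ j
... | yes _ = refl
... | no _ = refl

δ-sym : ∀ {N} (i j : Fin N) x → δ i j x ≡ δ j i x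
δ-sym i j x with i F.≟ j | j F.≟ i
... | yes _ | yes _ = refl
... | no _ | no _ = refl
... | yes i≡j | no j≢i = ⊥-elim (j≢i (Eq.sym i≡j))
... | no i≢j | yes j≡i = ⊥-elim (i≢j (Eq.sym j≡i))

δ-scale : ∀ {N} (i j : Fin N) x → δ i j x ≈ x *ᴾ δ i j 1ᴾ
δ-scale i j x with i F.≟ j
... | yes _ = ≈-sym (*-identityʳ x)
... | no _ = ≈-sym (*-zeroʳ x)

sum-δ : ∀ {N} (f : Fin N → Poly) (j : Fin N) x → sumᴾ (λ i → f i *ᴾ δ i j x) ≈ f j *ᴾ x
sum-δ {suc N} f zero x =
  ≈-trans (+-cong ≈-refl (sum-zero (λ i → *-zeroʳ (f (suc i))))) (+-identityʳ _)
sum-δ {suc N} f (suc j) x =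
  +-cong (*-zeroʳ (f zero))
         (≈-trans (sum-cong (λ i → *-congʳ (f (suc i)) (≡⇒≈ (δ-suc i j x))))
                  (sum-δ (λ i → f (suc i)) j x))

sum-δˡ : ∀ {N} (f : Fin N → Poly) (i : Fin N) x → sumᴾ (λ j → δ i j x *ᴾ f j) ≈ x *ᴾ f i
sum-δˡ f i x = ≈-trans (sum-cong (λ j → ≈-trans (*-comm (δ i j x) (f j)) (≡⇒≈ (cong (f j *ᴾ_) (δ-sym i j x)))))
                       (≈-trans (sum-δ f i x) (*-comm (f i) x))

sum-δ-column : ∀ {N} (j : Fin N) x → sumᴾ (λ i → δ i j x) ≈ x
sum-δ-column j x = ≈-trans (sum-cong (λ i → ≈-sym (*-identityˡ (δ i j x))))
                           (≈-trans (sum-δ (λ _ → 1ᴾ) j x) (*-identityˡ x))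

sum-δ-row : ∀ {N} (i : Fin N) x → sumᴾ (λ j → δ i j x) ≈ x
sum-δ-row i x = ≈-trans (sum-cong (λ j → ≡⇒≈ (δ-sym i j x))) (sum-δ-column i x)

Mat : ℕ → Set
Mat N = Fin N → Fin N → Poly

minor : ∀ {N} → Mat (suc N) → Fin (suc N) → Mat N
minor M j i k = M (suc i) (punchIn j k)

term : ∀ {N} → Mat (suc N) → Fin (suc N) → Poly
term M j = signᴾ (toℕ j) *ᴾ M zero j *ᴾ det (minor M j)

det-cong : ∀ {N} {M M' : Mat N} → (∀ i j → M i j ≈ M' i j) → det M ≈ det M'
det-cong {zero} e = ≈-refl
det-cong {suc N} e = sum-cong (λ j → *-cong (*-congʳ (signᴾ (toℕ j)) (e zero j))
                                            (det-cong (λ i k → e (suc i) (punchIn j k))))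

-- Induction: row 0 enters each term of the
-- expansion linearly, any other row is a row of every minor.
det-linear : ∀ {N} (M M₁ M₂ : Mat N) (i : Fin N) (a b : Poly) →
  (∀ k → k ≢ i → ∀ j → (M k j ≈ M₁ k j) × (M k j ≈ M₂ k j)) →
  (∀ j → M i j ≈ a *ᴾ M₁ i j +ᴾ b *ᴾ M₂ i j) →
  det M ≈ a *ᴾ det M₁ +ᴾ b *ᴾ det M₂
det-linear {suc N} M M₁ M₂ i a b others row-i = begin
    sumᴾ (term M)
  ≈⟨ sum-cong (term-linear i others row-i) ⟩
    sumᴾ (λ j → a *ᴾ term M₁ j +ᴾ b *ᴾ term M₂ j)
  ≈⟨ sum-+ (λ j → a *ᴾ term M₁ j) (λ j → b *ᴾ term M₂ j) ⟩
    sumᴾ (λ j → a *ᴾ term M₁ j) +ᴾ sumᴾ (λ j → b *ᴾ term M₂ j)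
  ≈⟨ +-cong (≈-sym (sum-*ˡ a (term M₁))) (≈-sym (sum-*ˡ b (term M₂))) ⟩
    a *ᴾ det M₁ +ᴾ b *ᴾ det M₂
  ∎
  where
  open ≈-Reasoning
  expand-row : ∀ s x y d → s *ᴾ (a *ᴾ x +ᴾ b *ᴾ y) *ᴾ d ≈ a *ᴾ (s *ᴾ x *ᴾ d) +ᴾ b *ᴾ (s *ᴾ y *ᴾ d)
  expand-row s x y d = ring s a b x y d
    where
    ring : ∀ s a b x y d → s *ᴾ (a *ᴾ x +ᴾ b *ᴾ y) *ᴾ d ≈ a *ᴾ (s *ᴾ x *ᴾ d) +ᴾ b *ᴾ (s *ᴾ y *ᴾ d)
    ring = solve-∀ ℤ[λ]-solver
  expand-minor : ∀ s x d₁ d₂ → s *ᴾ x *ᴾ (a *ᴾ d₁ +ᴾ b *ᴾ d₂) ≈ a *ᴾ (s *ᴾ x *ᴾ d₁) +ᴾ b *ᴾ (s *ᴾ x *ᴾ d₂)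
  expand-minor s x d₁ d₂ = ring s x a b d₁ d₂
    where
    ring : ∀ s x a b d₁ d₂ → s *ᴾ x *ᴾ (a *ᴾ d₁ +ᴾ b *ᴾ d₂) ≈ a *ᴾ (s *ᴾ x *ᴾ d₁) +ᴾ b *ᴾ (s *ᴾ x *ᴾ d₂)
    ring = solve-∀ ℤ[λ]-solver
  term-linear : ∀ i → (∀ k → k ≢ i → ∀ j → (M k j ≈ M₁ k j) × (M k j ≈ M₂ k j)) →
                (∀ j → M i j ≈ a *ᴾ M₁ i j +ᴾ b *ᴾ M₂ i j) →
                ∀ j → term M j ≈ a *ᴾ term M₁ j +ᴾ b *ᴾ term M₂ j
  term-linear zero others row-0 j =
    ≈-trans (*-cong (*-congʳ s (row-0 j)) (det-cong (λ i k → proj₁ (others (suc i) (λ ()) (punchIn j k)))))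
            (≈-trans (expand-row s (M₁ zero j) (M₂ zero j) (det (minor M₁ j)))
                     (+-cong ≈-refl (*-congʳ b (*-congʳ (s *ᴾ M₂ zero j) (det-cong same-minors)))))
    where
    s : Poly
    s = signᴾ (toℕ j)
    same-minors : ∀ i k → minor M₁ j i k ≈ minor M₂ j i k
    same-minors i k = ≈-trans (≈-sym (proj₁ (others (suc i) (λ ()) (punchIn j k))))
                              (proj₂ (others (suc i) (λ ()) (punchIn j k)))
  term-linear (suc i) others row-i j =
    ≈-trans (*-congʳ (s *ᴾ M zero j)
               (det-linear (minor M j) (minor M₁ j) (minor M₂ j) i a b
                  (λ k k≢i l → others (suc k) (λ e → k≢i (FP.suc-injective e)) (punchIn j l))
                  (λ l → row-i (punchIn j l))))
            (≈-trans (expand-minor s (M zero j) (det (minor M₁ j)) (det (minor M₂ j)))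
                     (+-cong (*-congʳ a (*-congˡ (det (minor M₁ j)) (*-congʳ s (proj₁ (others zero (λ ()) j)))))
                             (*-congʳ b (*-congˡ (det (minor M₂ j)) (*-congʳ s (proj₂ (others zero (λ ()) j)))))))
    where
    s : Poly
    s = signᴾ (toℕ j)

-- Expanding along the first two rows,
-- det M is a double sum over the columns a ≠ b chosen in rows 0 and 1;
-- the sign attached to (a, b) is antisymmetric, so swapping rows 0 and 1
-- negates the determinant.  Two equal rows are then reduced to that case.

sign-suc : ∀ k → signᴾ (suc k) ≈ -ᴾ signᴾ k
sign-suc zero = ≈-refl
sign-suc (suc zero) = mk λ { zero → refl ; (suc k) → refl }
sign-suc (suc (suc k)) = sign-suc k

-- deleting two distinct columns a and b, in either order, leaves the same columns
punchIn-punchOut-comm : ∀ {N} (a b : Fin (suc (suc N))) (a≢b : a ≢ b) (b≢a : b ≢ a) (l : Fin N) →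
  punchIn a (punchIn (punchOut a≢b) l) ≡ punchIn b (punchIn (punchOut b≢a) l)
punchIn-punchOut-comm zero zero a≢b b≢a l = ⊥-elim (a≢b refl)
punchIn-punchOut-comm {suc N} zero (suc b) a≢b b≢a l = refl
punchIn-punchOut-comm {suc N} (suc a) zero a≢b b≢a l = refl
punchIn-punchOut-comm {suc N} (suc a) (suc b) a≢b b≢a zero = refl
punchIn-punchOut-comm {suc N} (suc a) (suc b) a≢b b≢a (suc l) =
  cong suc (punchIn-punchOut-comm a b (λ e → a≢b (cong suc e)) (λ e → b≢a (cong suc e)) l)

-- the sign of the term using column a in row 0 and column b in row 1
pairSign : ∀ {K} (a b : Fin (suc K)) → a ≢ b → Poly
pairSign a b a≢b = signᴾ (toℕ a) *ᴾ signᴾ (toℕ (punchOut a≢b))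

pairSign-anti : ∀ {N} (a b : Fin (suc (suc N))) (a≢b : a ≢ b) (b≢a : b ≢ a) →
  pairSign a b a≢b ≈ -ᴾ pairSign b a b≢a
pairSign-anti zero zero a≢b b≢a = ⊥-elim (a≢b refl)
pairSign-anti zero (suc b) a≢b b≢a = begin
    1ᴾ *ᴾ signᴾ (toℕ b)         ≈⟨ *-identityˡ _ ⟩
    signᴾ (toℕ b)               ≈⟨ ≈-sym (neg-involutive (signᴾ (toℕ b))) ⟩
    -ᴾ (-ᴾ signᴾ (toℕ b))       ≈⟨ neg-cong (≈-sym (sign-suc (toℕ b))) ⟩
    -ᴾ signᴾ (suc (toℕ b))      ≈⟨ neg-cong (≈-sym (*-identityʳ _)) ⟩
    -ᴾ (signᴾ (suc (toℕ b)) *ᴾ 1ᴾ) ∎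
  where
  open ≈-Reasoning
  neg-involutive : ∀ x → -ᴾ (-ᴾ x) ≈ x
  neg-involutive = solve-∀ ℤ[λ]-solver
pairSign-anti (suc a) zero a≢b b≢a =
  ≈-trans (*-identityʳ _) (≈-trans (sign-suc (toℕ a)) (neg-cong (≈-sym (*-identityˡ _))))
pairSign-anti {suc N} (suc a) (suc b) a≢b b≢a = begin
    signᴾ (suc (toℕ a)) *ᴾ signᴾ (suc (toℕ (punchOut a≢b')))  ≈⟨ sign-suc² (toℕ a) (toℕ (punchOut a≢b')) ⟩
    pairSign a b a≢b'                                        ≈⟨ pairSign-anti a b a≢b' b≢a' ⟩
    -ᴾ pairSign b a b≢a'                                     ≈⟨ neg-cong (≈-sym (sign-suc² (toℕ b) (toℕ (punchOut b≢a')))) ⟩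
    -ᴾ (signᴾ (suc (toℕ b)) *ᴾ signᴾ (suc (toℕ (punchOut b≢a')))) ∎
  where
  open ≈-Reasoning
  a≢b' : a ≢ b
  a≢b' e = a≢b (cong suc e)
  b≢a' : b ≢ a
  b≢a' e = b≢a (cong suc e)
  neg-mul-neg : ∀ x y → (-ᴾ x) *ᴾ (-ᴾ y) ≈ x *ᴾ y
  neg-mul-neg = solve-∀ ℤ[λ]-solver
  sign-suc² : ∀ k l → signᴾ (suc k) *ᴾ signᴾ (suc l) ≈ signᴾ k *ᴾ signᴾ l
  sign-suc² k l = ≈-trans (*-cong (sign-suc k) (sign-suc l)) (neg-mul-neg (signᴾ k) (signᴾ l))
pairSign-anti {zero} (suc zero) (suc zero) a≢b b≢a = ⊥-elim (a≢b refl)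

module TwoRowExpansion {N : ℕ} (R : Fin N → Fin (suc (suc N)) → Poly) where

  pairMinor : Fin (suc (suc N)) → Fin (suc N) → Poly
  pairMinor a k = det (λ i l → R i (punchIn a (punchIn k l)))

  pairTerm : (u v : Fin (suc (suc N)) → Poly) → Fin (suc (suc N)) → Fin (suc (suc N)) → Poly
  pairTerm u v a b with a F.≟ b
  ... | yes _ = 0ᴾ
  ... | no a≢b = pairSign a b a≢b *ᴾ (u a *ᴾ v b) *ᴾ pairMinor a (punchOut a≢b)

  pairTerm-diagonal : ∀ u v a → pairTerm u v a a ≈ 0ᴾ
  pairTerm-diagonal u v a with a F.≟ a
  ... | yes _ = ≈-refl
  ... | no a≢a = ⊥-elim (a≢a refl)

  pairTerm-punchIn : ∀ u v j k → pairTerm u v j (punchIn j k)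
    ≈ signᴾ (toℕ j) *ᴾ signᴾ (toℕ k) *ᴾ (u j *ᴾ v (punchIn j k)) *ᴾ pairMinor j k
  pairTerm-punchIn u v j k with j F.≟ punchIn j k
  ... | yes e = ⊥-elim (FP.punchInᵢ≢i j k (Eq.sym e))
  ... | no j≢b = ≡⇒≈ (cong (λ z → signᴾ (toℕ j) *ᴾ signᴾ (toℕ z) *ᴾ (u j *ᴾ v (punchIn j k)) *ᴾ pairMinor j z)
                           (Eq.trans (FP.punchOut-cong j refl) (FP.punchOut-punchIn j)))

  pairTerm-anti : ∀ u v a b → pairTerm v u a b ≈ -ᴾ pairTerm u v b a
  pairTerm-anti u v a b with a F.≟ b | b F.≟ a
  ... | yes _ | yes _ = ≈-refl
  ... | yes a≡b | no b≢a = ⊥-elim (b≢a (Eq.sym a≡b))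
  ... | no a≢b | yes b≡a = ⊥-elim (a≢b (Eq.sym b≡a))
  ... | no a≢b | no b≢a =
    ≈-trans (*-cong (*-cong (pairSign-anti a b a≢b b≢a) (*-comm (v a) (u b)))
                    (det-cong (λ i l → ≡⇒≈ (cong (R i) (punchIn-punchOut-comm a b a≢b b≢a l)))))
            (neg-mul-mul (pairSign b a b≢a) (u b *ᴾ v a) (pairMinor b (punchOut b≢a)))
    where
    neg-mul-mul : ∀ x y z → (-ᴾ x) *ᴾ y *ᴾ z ≈ -ᴾ (x *ᴾ y *ᴾ z)
    neg-mul-mul = solve-∀ ℤ[λ]-solver

two-row-expansion : ∀ {N} (M : Mat (suc (suc N))) →
  det M ≈ sumᴾ (λ a → sumᴾ (λ b → TwoRowExpansion.pairTerm (λ i → M (suc (suc i))) (M zero) (M (suc zero)) a b))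
two-row-expansion {N} M = begin
    sumᴾ (λ j → signᴾ (toℕ j) *ᴾ M zero j *ᴾ sumᴾ (λ k → signᴾ (toℕ k) *ᴾ M (suc zero) (punchIn j k) *ᴾ pairMinor j k))
  ≈⟨ sum-cong (λ j → sum-*ˡ (signᴾ (toℕ j) *ᴾ M zero j) (λ k → signᴾ (toℕ k) *ᴾ M (suc zero) (punchIn j k) *ᴾ pairMinor j k)) ⟩
    sumᴾ (λ j → sumᴾ (λ k → signᴾ (toℕ j) *ᴾ M zero j *ᴾ (signᴾ (toℕ k) *ᴾ M (suc zero) (punchIn j k) *ᴾ pairMinor j k)))
  ≈⟨ sum-cong (λ j → sum-cong (λ k → ≈-trans (regroup (signᴾ (toℕ j)) (M zero j) (signᴾ (toℕ k)) (M (suc zero) (punchIn j k)) (pairMinor j k)) (≈-sym (pairTerm-punchIn (M zero) (M (suc zero)) j k)))) ⟩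
    sumᴾ (λ j → sumᴾ (λ k → pairTerm (M zero) (M (suc zero)) j (punchIn j k)))
  ≈⟨ sum-cong (λ j → ≈-trans (≈-sym (+-identityʳ _))
                       (≈-trans (+-cong ≈-refl (≈-sym (pairTerm-diagonal (M zero) (M (suc zero)) j)))
                                (sum-punchIn (pairTerm (M zero) (M (suc zero)) j) j))) ⟩
    sumᴾ (λ a → sumᴾ (λ b → pairTerm (M zero) (M (suc zero)) a b))
  ∎
  where
  open ≈-Reasoning
  open TwoRowExpansion (λ i → M (suc (suc i)))
  regroup : ∀ s x t y d → s *ᴾ x *ᴾ (t *ᴾ y *ᴾ d) ≈ s *ᴾ t *ᴾ (x *ᴾ y) *ᴾ d
  regroup = solve-∀ ℤ[λ]-solver

swapRows01 : ∀ {N} → Mat (suc (suc N)) → Mat (suc (suc N))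
swapRows01 M zero = M (suc zero)
swapRows01 M (suc zero) = M zero
swapRows01 M (suc (suc i)) = M (suc (suc i))

det-swapRows01 : ∀ {N} (M : Mat (suc (suc N))) → det (swapRows01 M) ≈ -ᴾ det M
det-swapRows01 {N} M = begin
    det (swapRows01 M)
  ≈⟨ two-row-expansion (swapRows01 M) ⟩
    sumᴾ (λ a → sumᴾ (λ b → pairTerm (M (suc zero)) (M zero) a b))
  ≈⟨ sum-cong (λ a → sum-cong (λ b → pairTerm-anti (M zero) (M (suc zero)) a b)) ⟩
    sumᴾ (λ a → sumᴾ (λ b → -ᴾ pairTerm (M zero) (M (suc zero)) b a))
  ≈⟨ sum-cong (λ a → ≈-sym (sum-neg (λ b → pairTerm (M zero) (M (suc zero)) b a))) ⟩
    sumᴾ (λ a → -ᴾ sumᴾ (λ b → pairTerm (M zero) (M (suc zero)) b a))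
  ≈⟨ ≈-sym (sum-neg (λ a → sumᴾ (λ b → pairTerm (M zero) (M (suc zero)) b a))) ⟩
    -ᴾ sumᴾ (λ a → sumᴾ (λ b → pairTerm (M zero) (M (suc zero)) b a))
  ≈⟨ neg-cong (sum-swap (λ a b → pairTerm (M zero) (M (suc zero)) b a)) ⟩
    -ᴾ sumᴾ (λ b → sumᴾ (λ a → pairTerm (M zero) (M (suc zero)) b a))
  ≈⟨ neg-cong (≈-sym (two-row-expansion M)) ⟩
    -ᴾ det M
  ∎
  where
  open ≈-Reasoning
  open TwoRowExpansion (λ i → M (suc (suc i)))

self-neg-zero : ∀ {p} → p ≈ -ᴾ p → p ≈ 0ᴾ
self-neg-zero {p} e = mk λ k → double-zero (coeff p k) (begin
    coeff p k ℤ.+ coeff p k        ≡⟨ cong (λ z → coeff p k ℤ.+ z) (get e k) ⟩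
    coeff p k ℤ.+ coeff (-ᴾ p) k   ≡⟨ Eq.sym (coeff-+ p (-ᴾ p) k) ⟩
    coeff (p +ᴾ (-ᴾ p)) k          ≡⟨ get (+-inverseʳ p) k ⟩
    + 0                            ∎)
  where
  open Eq.≡-Reasoning
  double-zero : ∀ c → c ℤ.+ c ≡ + 0 → c ≡ + 0
  double-zero (+ zero) e = refl
  double-zero (+ suc n) ()
  double-zero -[1+ n ] ()

mutual
  det-equal-rows : ∀ {N} (M : Mat N) (a b : Fin N) → a ≢ b → (∀ j → M a j ≈ M b j) → det M ≈ 0ᴾ
  det-equal-rows {suc N} M zero zero a≢b e = ⊥-elim (a≢b refl)
  det-equal-rows {suc N} M zero (suc b) a≢b e = det-equal-row0 M b e
  det-equal-rows {suc N} M (suc a) zero a≢b e = det-equal-row0 M a (λ j → ≈-sym (e j))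
  det-equal-rows {suc N} M (suc a) (suc b) a≢b e =
    sum-zero (λ j → mul-zero (signᴾ (toℕ j) *ᴾ M zero j)
      (det-equal-rows (minor M j) a b (λ a≡b → a≢b (cong suc a≡b)) (λ k → e (punchIn j k))))

  det-equal-row0 : ∀ {N} (M : Mat (suc N)) (b : Fin N) → (∀ j → M zero j ≈ M (suc b) j) → det M ≈ 0ᴾ
  det-equal-row0 {suc N} M zero e =
    self-neg-zero (≈-trans (det-cong {M = M} {M' = swapRows01 M} (λ { zero j → e j ; (suc zero) j → ≈-sym (e j) ; (suc (suc i)) j → ≈-refl }))
                           (det-swapRows01 M))
  det-equal-row0 {suc N} M (suc b) e = begin
    det M                          ≈⟨ det-cong {M = M} {M' = swapRows01 (swapRows01 M)} (λ { zero j → ≈-refl ; (suc zero) j → ≈-refl ; (suc (suc i)) j → ≈-refl }) ⟩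
    det (swapRows01 (swapRows01 M)) ≈⟨ det-swapRows01 (swapRows01 M) ⟩
    -ᴾ det (swapRows01 M)           ≈⟨ neg-cong (sum-zero (λ j → mul-zero (signᴾ (toℕ j) *ᴾ M (suc zero) j)
                                        (det-equal-rows (minor (swapRows01 M) j) zero (suc b) (λ ())
                                                        (λ k → e (punchIn j k))))) ⟩
    -ᴾ 0ᴾ                           ≈⟨ ≈-refl ⟩
    0ᴾ                              ∎
    where open ≈-Reasoning

replaceRow : ∀ {N} → Mat N → Fin N → (Fin N → Poly) → Mat N
replaceRow M i w k = if ⌊ k F.≟ i ⌋ then w else M k

replaceRow-same : ∀ {N} (M : Mat N) i w j → replaceRow M i w i j ≈ w j
replaceRow-same M i w j with i F.≟ i
... | yes _ = ≈-refl
... | no i≢i = ⊥-elim (i≢i refl)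

replaceRow-other : ∀ {N} (M : Mat N) i w k → k ≢ i → ∀ j → replaceRow M i w k j ≈ M k j
replaceRow-other M i w k k≢i j with k F.≟ i
... | yes k≡i = ⊥-elim (k≢i k≡i)
... | no _ = ≈-refl

replaceRow-others : ∀ {N} (M : Mat N) i w w' k → k ≢ i → ∀ j → replaceRow M i w k j ≈ replaceRow M i w' k j
replaceRow-others M i w w' k k≢i j =
  ≈-trans (replaceRow-other M i w k k≢i j) (≈-sym (replaceRow-other M i w' k k≢i j))

det-replaceRow-sum : ∀ {N K} (M : Mat N) i (f : Fin K → Fin N → Poly) →
  det (replaceRow M i (λ j → sumᴾ (λ k → f k j))) ≈ sumᴾ (λ k → det (replaceRow M i (f k)))
det-replaceRow-sum {K = zero} M i f =
  det-linear (replaceRow M i (λ j → 0ᴾ)) M M i 0ᴾ 0ᴾ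
    (λ k k≢i j → replaceRow-other M i _ k k≢i j , replaceRow-other M i _ k k≢i j)
    (replaceRow-same M i (λ j → 0ᴾ))
det-replaceRow-sum {K = suc K} M i f =
  ≈-trans (det-linear (replaceRow M i (λ j → sumᴾ (λ k → f k j))) (replaceRow M i (f zero))
                      (replaceRow M i rest) i 1ᴾ 1ᴾ
             (λ k k≢i j → replaceRow-others M i _ _ k k≢i j , replaceRow-others M i _ _ k k≢i j)
             (λ j → ≈-trans (replaceRow-same M i _ j)
                      (≈-sym (+-cong (≈-trans (*-identityˡ _) (replaceRow-same M i (f zero) j))
                                     (≈-trans (*-identityˡ _) (replaceRow-same M i rest j))))))
          (+-cong (*-identityˡ _) (≈-trans (*-identityˡ _) (det-replaceRow-sum M i (λ k → f (suc k)))))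
  where
  rest : Fin _ → Poly
  rest j = sumᴾ (λ k → f (suc k) j)

-- Adding to row i a combination Σ_k c k · (row k) of the other rows
-- (c i = 0) does not change the determinant: by linearity the change is
-- Σ_k c k · det(M with row i replaced by row k), and each of these
-- determinants has two equal rows.
det-addCombination : ∀ {N} (M M' : Mat N) (i : Fin N) (c : Fin N → Poly) → c i ≈ 0ᴾ →
  (∀ k → k ≢ i → ∀ j → M' k j ≈ M k j) →
  (∀ j → M' i j ≈ M i j +ᴾ sumᴾ (λ k → c k *ᴾ M k j)) → det M' ≈ det M
det-addCombination {N} M M' i c cᵢ≈0 others row-i = begin
    det M'
  ≈⟨ det-linear M' M (replaceRow M i combination) i 1ᴾ 1ᴾ
       (λ k k≢i j → others k k≢i j , ≈-trans (others k k≢i j) (≈-sym (replaceRow-other M i combination k k≢i j)))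
       (λ j → ≈-trans (row-i j) (+-cong (≈-sym (*-identityˡ _))
                                        (≈-sym (≈-trans (*-identityˡ _) (replaceRow-same M i combination j))))) ⟩
    1ᴾ *ᴾ det M +ᴾ 1ᴾ *ᴾ det (replaceRow M i combination)
  ≈⟨ +-cong (*-identityˡ _) (≈-trans (*-identityˡ _) (det-replaceRow-sum M i (λ k j → c k *ᴾ M k j))) ⟩
    det M +ᴾ sumᴾ (λ k → det (replaceRow M i (λ j → c k *ᴾ M k j)))
  ≈⟨ +-cong ≈-refl (sum-zero each-zero) ⟩
    det M +ᴾ 0ᴾ
  ≈⟨ +-identityʳ _ ⟩
    det M
  ∎
  where
  open ≈-Reasoning
  combination : Fin N → Poly
  combination j = sumᴾ (λ k → c k *ᴾ M k j)
  -- c k · det(M with row i replaced by row k) vanishes: c i = 0, and for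
  -- k ≠ i rows i and k coincide
  scaled-zero : ∀ k → Dec (k ≡ i) → c k *ᴾ det (replaceRow M i (M k)) ≈ 0ᴾ
  scaled-zero k (yes refl) = zero-mul _ cᵢ≈0
  scaled-zero k (no k≢i) = mul-zero (c k) (det-equal-rows (replaceRow M i (M k)) i k (λ e → k≢i (Eq.sym e))
    (λ j → ≈-trans (replaceRow-same M i (M k) j) (≈-sym (replaceRow-other M i (M k) k k≢i j))))
  each-zero : ∀ k → det (replaceRow M i (λ j → c k *ᴾ M k j)) ≈ 0ᴾ
  each-zero k = ≈-trans
    (det-linear (replaceRow M i (λ j → c k *ᴾ M k j)) (replaceRow M i (M k)) (replaceRow M i (M k)) i (c k) 0ᴾ
       (λ l l≢i j → replaceRow-others M i _ _ l l≢i j , replaceRow-others M i _ _ l l≢i j)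
       (λ j → ≈-trans (replaceRow-same M i _ j)
                (≈-trans (*-congʳ (c k) (≈-sym (replaceRow-same M i (M k) j))) (≈-sym (+-identityʳ _)))))
    (≈-trans (+-identityʳ _) (scaled-zero k (k F.≟ i)))

-- Several such operations at once: M' i = M i + Σ_k c i k · M k, where
-- every row k used as a source (c i k ≠ 0) is itself left unchanged.
-- The operations are performed one row at a time, top to bottom.
module SimultaneousRowOps {N : ℕ} (M M' : Mat N) (c : Fin N → Fin N → Poly)
  (source-fixed : ∀ i k → (c i k ≈ 0ᴾ) ⊎ (∀ l → c k l ≈ 0ᴾ))
  (M'-def : ∀ i j → M' i j ≈ M i j +ᴾ sumᴾ (λ k → c i k *ᴾ M k j)) where

  stage : ℕ → Mat N
  stage a i j = if toℕ i ℕ.<ᵇ a then M' i j else M i j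

  stage-done : ∀ a i j → toℕ i ℕ.< a → stage a i j ≡ M' i j
  stage-done a i j lt with toℕ i ℕ.<ᵇ a | ℕP.<⇒<ᵇ {toℕ i} {a} lt
  ... | true | _ = refl
  ... | false | ()

  stage-todo : ∀ a i j → ¬ (toℕ i ℕ.< a) → stage a i j ≡ M i j
  stage-todo a i j nlt with toℕ i ℕ.<ᵇ a | ℕP.<ᵇ⇒< (toℕ i) a
  ... | true | lt = ⊥-elim (nlt (lt _))
  ... | false | _ = refl

  stage-fixed : ∀ a k → (∀ l → c k l ≈ 0ᴾ) → ∀ j → stage a k j ≈ M k j
  stage-fixed a k cₖ≈0 j with toℕ k ℕ.<ᵇ a
  ... | true = ≈-trans (M'-def k j) (≈-trans (+-cong ≈-refl (sum-zero (λ l → zero-mul (M l j) (cₖ≈0 l))))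
                                             (+-identityʳ _))
  ... | false = ≈-refl

  det-step : ∀ a → det (stage (suc a)) ≈ det (stage a)
  det-step a with a ℕ.<? N
  ... | no a≮N = det-cong (λ i j → ≡⇒≈ (Eq.trans (stage-done (suc a) i j (ℕP.m<n⇒m<1+n (lt i)))
                                                 (Eq.sym (stage-done a i j (lt i)))))
    where
    lt : ∀ (i : Fin N) → toℕ i ℕ.< a
    lt i = ℕP.<-≤-trans (FP.toℕ<n i) (ℕP.≮⇒≥ a≮N)
  ... | yes a<N = det-addCombination (stage a) (stage (suc a)) i₀ (c i₀) cᵢᵢ others row-i₀
    where
    i₀ : Fin N
    i₀ = fromℕ< a<N
    toℕ-i₀ : toℕ i₀ ≡ a
    toℕ-i₀ = FP.toℕ-fromℕ< a<N
    cᵢᵢ : c i₀ i₀ ≈ 0ᴾ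
    cᵢᵢ with source-fixed i₀ i₀
    ... | inj₁ z = z
    ... | inj₂ z = z i₀
    others : ∀ k → k ≢ i₀ → ∀ j → stage (suc a) k j ≈ stage a k j
    others k k≢i₀ j with toℕ k ℕ.<? a
    ... | yes lt = ≡⇒≈ (Eq.trans (stage-done (suc a) k j (ℕP.m<n⇒m<1+n lt)) (Eq.sym (stage-done a k j lt)))
    ... | no nlt = ≡⇒≈ (Eq.trans (stage-todo (suc a) k j not-next) (Eq.sym (stage-todo a k j nlt)))
      where
      not-next : ¬ (toℕ k ℕ.< suc a)
      not-next lt = k≢i₀ (FP.toℕ-injective (Eq.trans (ℕP.≤-antisym (ℕP.≤-pred lt) (ℕP.≮⇒≥ nlt)) (Eq.sym toℕ-i₀)))
    source : ∀ k → (c i₀ k ≈ 0ᴾ) ⊎ (∀ l → c k l ≈ 0ᴾ) → ∀ j → c i₀ k *ᴾ M k j ≈ c i₀ k *ᴾ stage a k j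
    source k (inj₁ z) j = ≈-trans (zero-mul (M k j) z) (≈-sym (zero-mul (stage a k j) z))
    source k (inj₂ z) j = *-congʳ (c i₀ k) (≈-sym (stage-fixed a k z j))
    row-i₀ : ∀ j → stage (suc a) i₀ j ≈ stage a i₀ j +ᴾ sumᴾ (λ k → c i₀ k *ᴾ stage a k j)
    row-i₀ j = ≈-trans (≡⇒≈ (stage-done (suc a) i₀ j (ℕP.≤-reflexive (cong suc toℕ-i₀))))
      (≈-trans (M'-def i₀ j) (+-cong (≈-sym (≡⇒≈ (stage-todo a i₀ j (ℕP.<-irrefl toℕ-i₀))))
                                     (sum-cong (λ k → source k (source-fixed i₀ k) j))))

  det-stage : ∀ a → det (stage a) ≈ det M
  det-stage zero = det-cong (λ i j → ≡⇒≈ (stage-todo zero i j (λ ())))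
  det-stage (suc a) = ≈-trans (det-step a) (det-stage a)

  det-unchanged : det M' ≈ det M
  det-unchanged = ≈-trans (det-cong (λ i j → ≡⇒≈ (Eq.sym (stage-done N i j (FP.toℕ<n i))))) (det-stage N)

det-addCombinations : ∀ {N} (M M' : Mat N) (c : Fin N → Fin N → Poly) →
  (∀ i k → (c i k ≈ 0ᴾ) ⊎ (∀ l → c k l ≈ 0ᴾ)) →
  (∀ i j → M' i j ≈ M i j +ᴾ sumᴾ (λ k → c i k *ᴾ M k j)) → det M' ≈ det M
det-addCombinations M M' c source-fixed M'-def = SimultaneousRowOps.det-unchanged M M' c source-fixed M'-def

det-scaleRows : ∀ {N} (M M' : Mat N) (c : Fin N → Poly) →
  (∀ i j → M' i j ≈ c i *ᴾ M i j) → det M' ≈ prodᴾ c *ᴾ det M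
det-scaleRows {zero} M M' c e = ≈-sym (*-identityˡ 1ᴾ)
det-scaleRows {suc N} M M' c e = begin
    sumᴾ (term M')
  ≈⟨ sum-cong (λ j → *-cong (*-congʳ (signᴾ (toℕ j)) (e zero j))
                            (det-scaleRows (minor M j) (minor M' j) (λ i → c (suc i)) (λ i k → e (suc i) (punchIn j k)))) ⟩
    sumᴾ (λ j → signᴾ (toℕ j) *ᴾ (c zero *ᴾ M zero j) *ᴾ (prodᴾ (λ i → c (suc i)) *ᴾ det (minor M j)))
  ≈⟨ sum-cong (λ j → regroup (signᴾ (toℕ j)) (c zero) (M zero j) (prodᴾ (λ i → c (suc i))) (det (minor M j))) ⟩
    sumᴾ (λ j → prodᴾ c *ᴾ term M j)
  ≈⟨ ≈-sym (sum-*ˡ (prodᴾ c) (term M)) ⟩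
    prodᴾ c *ᴾ det M
  ∎
  where
  open ≈-Reasoning
  regroup : ∀ s a m p d → s *ᴾ (a *ᴾ m) *ᴾ (p *ᴾ d) ≈ a *ᴾ p *ᴾ (s *ᴾ m *ᴾ d)
  regroup = solve-∀ ℤ[λ]-solver

det-zeroFirstColumn : ∀ {N} (M : Mat (suc N)) → (∀ i → M i zero ≈ 0ᴾ) → det M ≈ 0ᴾ
det-zeroFirstColumn {zero} M z = +-cong (zero-mul _ (mul-zero (signᴾ 0) (z zero))) ≈-refl
det-zeroFirstColumn {suc N} M z =
  +-cong (zero-mul _ (mul-zero (signᴾ 0) (z zero)))
         (sum-zero (λ j → mul-zero (signᴾ (toℕ (suc j)) *ᴾ M zero (suc j))
                                   (det-zeroFirstColumn (minor M (suc j)) (λ i → z (suc i)))))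

identityMat : ∀ N → Mat N
identityMat N i j = δ i j 1ᴾ

det-identity : ∀ N → det (identityMat N) ≈ 1ᴾ
det-identity zero = ≈-refl
det-identity (suc N) = ≈-trans (+-cong first-term (sum-zero other-terms)) (+-identityʳ 1ᴾ)
  where
  first-term : term (identityMat (suc N)) zero ≈ 1ᴾ
  first-term = ≈-trans (*-congʳ (signᴾ 0 *ᴾ 1ᴾ)
                          (≈-trans (det-cong {M' = identityMat N} (λ i k → ≡⇒≈ (δ-suc i k 1ᴾ))) (det-identity N)))
                       (≈-trans (*-identityʳ _) (*-identityʳ 1ᴾ))
  other-terms : ∀ j → term (identityMat (suc N)) (suc j) ≈ 0ᴾ
  other-terms j = zero-mul (det (minor (identityMat (suc N)) (suc j))) (*-zeroʳ (signᴾ (toℕ (suc j))))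

det-scalar : ∀ N x → det {N} (λ i j → δ i j x) ≈ x ^ᴾ N
det-scalar N x =
  ≈-trans (det-scaleRows (identityMat N) (λ i j → δ i j x) (λ _ → x) (λ i j → δ-scale i j x))
          (≈-trans (*-cong (prod-const N x) (det-identity N)) (*-identityʳ (x ^ᴾ N)))

-- Block matrices.  Fin (n + m) is split into the first n indices
-- (i ↑ˡ m) and the last m indices (n ↑ʳ j).

data BlockIndex (n m : ℕ) : Fin (n ℕ.+ m) → Set where
  left : (i : Fin n) → BlockIndex n m (i ↑ˡ m)
  right : (j : Fin m) → BlockIndex n m (n ↑ʳ j)

blockIndex : ∀ n {m} (x : Fin (n ℕ.+ m)) → BlockIndex n m x
blockIndex zero x = right x
blockIndex (suc n) zero = left zero
blockIndex (suc n) (suc x) with blockIndex n x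
... | left i = left (suc i)
... | right j = right j

punchIn-↑ˡ : ∀ {n} m (j : Fin (suc n)) (k : Fin n) → punchIn (j ↑ˡ m) (k ↑ˡ m) ≡ punchIn j k ↑ˡ m
punchIn-↑ˡ m zero k = refl
punchIn-↑ˡ m (suc j) zero = refl
punchIn-↑ˡ m (suc j) (suc k) = cong suc (punchIn-↑ˡ m j k)

punchIn-↑ʳ : ∀ {n} m (j : Fin (suc n)) (k : Fin m) → punchIn (j ↑ˡ m) (n ↑ʳ k) ≡ suc n ↑ʳ k
punchIn-↑ʳ m zero k = refl
punchIn-↑ʳ {suc n} m (suc j) k = cong suc (punchIn-↑ʳ m j k)

↑ˡ≢↑ʳ : ∀ {n m} (i : Fin n) (j : Fin m) → i ↑ˡ m ≢ n ↑ʳ j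
↑ˡ≢↑ʳ {n} {m} i j e with Eq.trans (Eq.sym (FP.splitAt-↑ˡ n i m))
                                  (Eq.trans (cong (splitAt n) e) (FP.splitAt-↑ʳ n m j))
... | ()

O : ∀ {a b} → Fin a → Fin b → Poly
O _ _ = 0ᴾ

module _ {n m : ℕ} where

  blockMat : (Fin n → Fin n → Poly) → (Fin n → Fin m → Poly) → (Fin m → Fin n → Poly) → (Fin m → Fin m → Poly) →
             Mat (n ℕ.+ m)
  blockMat P Q R S x y = entry (splitAt n x) (splitAt n y)
    where
    entry : Fin n ⊎ Fin m → Fin n ⊎ Fin m → Poly
    entry (inj₁ i) (inj₁ j) = P i j
    entry (inj₁ i) (inj₂ j) = Q i j
    entry (inj₂ i) (inj₁ j) = R i j
    entry (inj₂ i) (inj₂ j) = S i j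

  blockVec : (Fin n → Poly) → (Fin m → Poly) → Fin (n ℕ.+ m) → Poly
  blockVec u v x = entry (splitAt n x)
    where
    entry : Fin n ⊎ Fin m → Poly
    entry (inj₁ i) = u i
    entry (inj₂ j) = v j

module BlockEntries {n m : ℕ} (P : Fin n → Fin n → Poly) (Q : Fin n → Fin m → Poly)
                             (R : Fin m → Fin n → Poly) (S : Fin m → Fin m → Poly) where
  ll : ∀ i j → blockMat P Q R S (i ↑ˡ m) (j ↑ˡ m) ≈ P i j
  ll i j rewrite FP.splitAt-↑ˡ n i m | FP.splitAt-↑ˡ n j m = ≈-refl
  lr : ∀ i j → blockMat P Q R S (i ↑ˡ m) (n ↑ʳ j) ≈ Q i j
  lr i j rewrite FP.splitAt-↑ˡ n i m | FP.splitAt-↑ʳ n m j = ≈-refl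
  rl : ∀ i j → blockMat P Q R S (n ↑ʳ i) (j ↑ˡ m) ≈ R i j
  rl i j rewrite FP.splitAt-↑ʳ n m i | FP.splitAt-↑ˡ n j m = ≈-refl
  rr : ∀ i j → blockMat P Q R S (n ↑ʳ i) (n ↑ʳ j) ≈ S i j
  rr i j rewrite FP.splitAt-↑ʳ n m i | FP.splitAt-↑ʳ n m j = ≈-refl

module BlockVecEntries {n m : ℕ} (u : Fin n → Poly) (v : Fin m → Poly) where
  l : ∀ i → blockVec u v (i ↑ˡ m) ≈ u i
  l i rewrite FP.splitAt-↑ˡ n i m = ≈-refl
  r : ∀ j → blockVec u v (n ↑ʳ j) ≈ v j
  r j rewrite FP.splitAt-↑ʳ n m j = ≈-refl

module _ {n m : ℕ} where

  δ-ll : ∀ (i j : Fin n) x → δ (i ↑ˡ m) (j ↑ˡ m) x ≈ δ i j x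
  δ-ll i j x with i F.≟ j | (i ↑ˡ m) F.≟ (j ↑ˡ m)
  ... | yes _ | yes _ = ≈-refl
  ... | no _ | no _ = ≈-refl
  ... | yes i≡j | no ne = ⊥-elim (ne (cong (_↑ˡ m) i≡j))
  ... | no i≢j | yes e = ⊥-elim (i≢j (FP.↑ˡ-injective m i j e))

  δ-rr : ∀ (i j : Fin m) x → δ (n ↑ʳ i) (n ↑ʳ j) x ≈ δ i j x
  δ-rr i j x with i F.≟ j | (n ↑ʳ i) F.≟ (n ↑ʳ j)
  ... | yes _ | yes _ = ≈-refl
  ... | no _ | no _ = ≈-refl
  ... | yes i≡j | no ne = ⊥-elim (ne (cong (n ↑ʳ_) i≡j))
  ... | no i≢j | yes e = ⊥-elim (i≢j (FP.↑ʳ-injective n i j e))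

  δ-lr : ∀ (i : Fin n) (j : Fin m) x → δ (i ↑ˡ m) (n ↑ʳ j) x ≈ 0ᴾ
  δ-lr i j x = ≡⇒≈ (δ-diff x (↑ˡ≢↑ʳ i j))

  δ-rl : ∀ (i : Fin n) (j : Fin m) x → δ (n ↑ʳ j) (i ↑ˡ m) x ≈ 0ᴾ
  δ-rl i j x = ≡⇒≈ (δ-diff x (λ e → ↑ˡ≢↑ʳ i j (Eq.sym e)))

  row-times-column : ∀ (f : Fin (n ℕ.+ m) → Poly) (M : Mat (n ℕ.+ m)) y (g : Fin n → Poly) (h : Fin m → Poly) →
    (∀ i → f (i ↑ˡ m) ≈ g i) → (∀ j → f (n ↑ʳ j) ≈ h j) →
    sumᴾ (λ k → f k *ᴾ M k y) ≈ sumᴾ (λ i → g i *ᴾ M (i ↑ˡ m) y) +ᴾ sumᴾ (λ j → h j *ᴾ M (n ↑ʳ j) y)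
  row-times-column f M y g h eg eh =
    ≈-trans (sum-split n (λ k → f k *ᴾ M k y))
            (+-cong (sum-cong (λ i → *-congˡ (M (i ↑ˡ m) y) (eg i))) (sum-cong (λ j → *-congˡ (M (n ↑ʳ j) y) (eh j))))

  -- coefficient matrices with a single off-diagonal block satisfy the
  -- side condition of det-addCombinations: the source rows are unchanged
  upperBlock-sources-fixed : ∀ (Q : Fin n → Fin m → Poly) i k →
    (blockMat O Q O O i k ≈ 0ᴾ) ⊎ (∀ l → blockMat O Q O O k l ≈ 0ᴾ)
  upperBlock-sources-fixed Q i k with blockIndex n k
  ... | right k' = inj₂ row-zero
    where
    open BlockEntries O Q O O
    row-zero : ∀ l → blockMat O Q O O (n ↑ʳ k') l ≈ 0ᴾ
    row-zero l with blockIndex n l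
    ... | left l' = rl k' l'
    ... | right l' = rr k' l'
  ... | left k' with blockIndex n i
  ...   | left i' = inj₁ (BlockEntries.ll O Q O O i' k')
  ...   | right i' = inj₁ (BlockEntries.rl O Q O O i' k')

  lowerBlock-sources-fixed : ∀ (R : Fin m → Fin n → Poly) i k →
    (blockMat O O R O i k ≈ 0ᴾ) ⊎ (∀ l → blockMat O O R O k l ≈ 0ᴾ)
  lowerBlock-sources-fixed R i k with blockIndex n k
  ... | left k' = inj₂ row-zero
    where
    open BlockEntries O O R O
    row-zero : ∀ l → blockMat O O R O (k' ↑ˡ m) l ≈ 0ᴾ
    row-zero l with blockIndex n l
    ... | left l' = ll k' l'
    ... | right l' = lr k' l'
  ... | right k' with blockIndex n i
  ...   | left i' = inj₁ (BlockEntries.lr O O R O i' k')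
  ...   | right i' = inj₁ (BlockEntries.rr O O R O i' k')

sum-zeros : ∀ N → sumᴾ {N} (λ _ → 0ᴾ) ≈ 0ᴾ
sum-zeros N = sum-zero {N} (λ _ → ≈-refl)

-- det [[P, 0], [*, S]] = det P · det S, by induction on the size of P:
-- expanding along row 0, only the columns of P contribute
det-blockLowerTriangular : ∀ n {m} (M : Mat (n ℕ.+ m)) (P : Mat n) (S : Mat m) →
  (∀ i j → M (i ↑ˡ m) (j ↑ˡ m) ≈ P i j) → (∀ i j → M (i ↑ˡ m) (n ↑ʳ j) ≈ 0ᴾ) →
  (∀ i j → M (n ↑ʳ i) (n ↑ʳ j) ≈ S i j) → det M ≈ det P *ᴾ det S
det-blockLowerTriangular zero M P S eP eZ eS = ≈-trans (det-cong eS) (≈-sym (*-identityˡ (det S)))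
det-blockLowerTriangular (suc n) {m} M P S eP eZ eS = begin
    sumᴾ (term M)
  ≈⟨ sum-split (suc n) (term M) ⟩
    sumᴾ (λ j → term M (j ↑ˡ m)) +ᴾ sumᴾ (λ k → term M (suc n ↑ʳ k))
  ≈⟨ +-cong (sum-cong left-term) (sum-zero right-term) ⟩
    sumᴾ (λ j → term P j *ᴾ det S) +ᴾ 0ᴾ
  ≈⟨ +-identityʳ _ ⟩
    sumᴾ (λ j → term P j *ᴾ det S)
  ≈⟨ ≈-sym (sum-*ʳ (det S) (term P)) ⟩
    det P *ᴾ det S
  ∎
  where
  open ≈-Reasoning
  left-term : ∀ j → term M (j ↑ˡ m) ≈ term P j *ᴾ det S
  left-term j =
    ≈-trans (*-cong (*-cong (≡⇒≈ (cong signᴾ (FP.toℕ-↑ˡ j m))) (eP zero j))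
                    (det-blockLowerTriangular n (minor M (j ↑ˡ m)) (minor P j) S
                       (λ i k → ≈-trans (≡⇒≈ (cong (M (suc i ↑ˡ m)) (punchIn-↑ˡ m j k))) (eP (suc i) (punchIn j k)))
                       (λ i k → ≈-trans (≡⇒≈ (cong (M (suc i ↑ˡ m)) (punchIn-↑ʳ m j k))) (eZ (suc i) k))
                       (λ i k → ≈-trans (≡⇒≈ (cong (M (suc (n ↑ʳ i))) (punchIn-↑ʳ m j k))) (eS i k))))
            (≈-sym (*-assoc (signᴾ (toℕ j) *ᴾ P zero j) (det (minor P j)) (det S)))
  right-term : ∀ k → term M (suc n ↑ʳ k) ≈ 0ᴾ
  right-term k = zero-mul (det (minor M (suc n ↑ʳ k))) (mul-zero (signᴾ (toℕ (suc n ↑ʳ k))) (eZ zero k))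

-- det [[I, *], [0, S]] = det S: expanding along row 0 only the diagonal
-- entry contributes, the other minors having a zero first column
det-blockUnitUpper : ∀ n {m} (M : Mat (n ℕ.+ m)) (S : Mat m) →
  (∀ i j → M (i ↑ˡ m) (j ↑ˡ m) ≈ δ i j 1ᴾ) → (∀ i j → M (n ↑ʳ i) (j ↑ˡ m) ≈ 0ᴾ) →
  (∀ i j → M (n ↑ʳ i) (n ↑ʳ j) ≈ S i j) → det M ≈ det S
det-blockUnitUpper zero M S eI eZ eS = det-cong eS
det-blockUnitUpper (suc n) {m} M S eI eZ eS =
  ≈-trans (+-cong first-term (sum-zero other-terms))
          (≈-trans (+-identityʳ _) (≈-trans (*-identityˡ (1ᴾ *ᴾ det S)) (*-identityˡ (det S))))
  where
  first-term : term M zero ≈ 1ᴾ *ᴾ (1ᴾ *ᴾ det S)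
  first-term = ≈-trans (*-cong (*-congʳ 1ᴾ (≈-trans (eI zero zero) (≡⇒≈ (δ-same {suc n} zero 1ᴾ))))
                               (det-blockUnitUpper n (minor M zero) S
                                  (λ i k → ≈-trans (eI (suc i) (suc k)) (≡⇒≈ (δ-suc i k 1ᴾ)))
                                  (λ i k → eZ i (suc k))
                                  eS))
                       (*-assoc 1ᴾ 1ᴾ (det S))
  first-column-zero : ∀ x → BlockIndex n m x → M (suc x) zero ≈ 0ᴾ
  first-column-zero .(i ↑ˡ m) (left i) = eI (suc i) zero
  first-column-zero .(n ↑ʳ j) (right j) = eZ j zero
  -- the first index of a nonempty Fin, named so that the minor's size n + m
  -- need not be exposed as a successor
  firstOf : ∀ {K} → Fin K → Fin K
  firstOf zero = zero
  firstOf (suc _) = zero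
  punchIn-firstOf : ∀ {K} (j : Fin K) → punchIn (suc j) (firstOf j) ≡ zero
  punchIn-firstOf zero = refl
  punchIn-firstOf (suc j) = refl
  minor-zero : ∀ {K} (A : Mat K) (x : Fin K) → (∀ i → A i (firstOf x) ≈ 0ᴾ) → det A ≈ 0ᴾ
  minor-zero {suc K} A zero z = det-zeroFirstColumn A z
  minor-zero {suc K} A (suc x) z = det-zeroFirstColumn A z
  other-terms : ∀ j → term M (suc j) ≈ 0ᴾ
  other-terms j = mul-zero (signᴾ (toℕ (suc j)) *ᴾ M zero (suc j))
    (minor-zero (minor M (suc j)) j
      (λ i → ≈-trans (≡⇒≈ (cong (M (suc i)) (punchIn-firstOf j))) (first-column-zero i (blockIndex n i))))

prod-blockVec : ∀ n m c → prodᴾ (blockVec {n} {m} (λ _ → c) (λ _ → 1ᴾ)) ≈ c ^ᴾ n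
prod-blockVec n m c = prod-split-const n m c _ (BlockVecEntries.l {n} {m} (λ _ → c) (λ _ → 1ᴾ))
                                               (BlockVecEntries.r {n} {m} (λ _ → c) (λ _ → 1ᴾ))

-- Sylvester's identity  λⁿ det(λI − HT) = λᵐ det(λI − TH)  for an n×m
-- matrix T and an m×n matrix H, via the block matrix K = [[I, T], [H, λI]]:
--   * subtracting H·(top rows) from the bottom rows gives [[I, T], [0, λI − HT]],
--     so det K = det(λI − HT);
--   * scaling the top rows by λ and then subtracting T·(bottom rows) from
--     them gives [[λI − TH, 0], [H, λI]], so λⁿ det K = det(λI − TH) λᵐ.
module Sylvester (n m : ℕ) (T : Fin n → Fin m → Poly) (H : Fin m → Fin n → Poly) where

  LT : Mat n
  LT i j = δ i j Xᴾ -ᴾ sumᴾ (λ p → T i p *ᴾ H p j)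
  LH : Mat m
  LH p q = δ p q Xᴾ -ᴾ sumᴾ (λ i → H p i *ᴾ T i q)

  K : Mat (n ℕ.+ m)
  K = blockMat (λ i j → δ i j 1ᴾ) T H (λ p q → δ p q Xᴾ)
  module K = BlockEntries {n} {m} (λ i j → δ i j 1ᴾ) T H (λ p q → δ p q Xᴾ)

  neg-mul : ∀ a b → (-ᴾ a) *ᴾ b ≈ -ᴾ (a *ᴾ b)
  neg-mul = solve-∀ ℤ[λ]-solver

  Cᴴ : Mat (n ℕ.+ m)
  Cᴴ = blockMat O O (λ p i → -ᴾ H p i) O
  module Cᴴ = BlockEntries {n} {m} O O (λ p i → -ᴾ H p i) O

  Kᴴ : Mat (n ℕ.+ m)
  Kᴴ x y = K x y +ᴾ sumᴾ (λ k → Cᴴ x k *ᴾ K k y)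

  det-Kᴴ : det Kᴴ ≈ det LH
  det-Kᴴ = det-blockUnitUpper n Kᴴ LH top-left bottom-left bottom-right
    where
    top-left : ∀ i j → Kᴴ (i ↑ˡ m) (j ↑ˡ m) ≈ δ i j 1ᴾ
    top-left i j = ≈-trans (+-cong (K.ll i j)
      (≈-trans (row-times-column (Cᴴ (i ↑ˡ m)) K (j ↑ˡ m) (O i) (O i) (Cᴴ.ll i) (Cᴴ.lr i))
               (+-cong (sum-zeros n) (sum-zeros m))))
      (+-identityʳ _)
    bottom-left : ∀ p j → Kᴴ (n ↑ʳ p) (j ↑ˡ m) ≈ 0ᴾ
    bottom-left p j = ≈-trans (+-cong (K.rl p j)
      (≈-trans (row-times-column (Cᴴ (n ↑ʳ p)) K (j ↑ˡ m) (λ i → -ᴾ H p i) (O p) (Cᴴ.rl p) (Cᴴ.rr p))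
        (≈-trans (+-cong (≈-trans (sum-cong (λ i → *-congʳ (-ᴾ H p i) (K.ll i j)))
                                  (sum-δ (λ i → -ᴾ H p i) j 1ᴾ))
                         (sum-zeros m))
                 (+-identityʳ _))))
      (cancel (H p j))
      where
      cancel : ∀ h → h +ᴾ (-ᴾ h) *ᴾ 1ᴾ ≈ 0ᴾ
      cancel = solve-∀ ℤ[λ]-solver
    bottom-right : ∀ p q → Kᴴ (n ↑ʳ p) (n ↑ʳ q) ≈ LH p q
    bottom-right p q = +-cong (K.rr p q)
      (≈-trans (row-times-column (Cᴴ (n ↑ʳ p)) K (n ↑ʳ q) (λ i → -ᴾ H p i) (O p) (Cᴴ.rl p) (Cᴴ.rr p))
        (≈-trans (+-cong (sum-cong (λ i → ≈-trans (*-congʳ (-ᴾ H p i) (K.lr i q)) (neg-mul (H p i) (T i q))))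
                         (sum-zeros m))
                 (≈-trans (+-identityʳ _) (≈-sym (sum-neg (λ i → H p i *ᴾ T i q))))))

  det-K : det K ≈ det LH
  det-K = ≈-trans (≈-sym (det-addCombinations K Kᴴ Cᴴ (lowerBlock-sources-fixed (λ p i → -ᴾ H p i)) (λ i j → ≈-refl)))
                  det-Kᴴ

  Kˢ : Mat (n ℕ.+ m)
  Kˢ x y = blockVec {n} {m} (λ _ → Xᴾ) (λ _ → 1ᴾ) x *ᴾ K x y
  module topByλ = BlockVecEntries {n} {m} (λ _ → Xᴾ) (λ _ → 1ᴾ)

  det-Kˢ : det Kˢ ≈ (Xᴾ ^ᴾ n) *ᴾ det K
  det-Kˢ = ≈-trans (det-scaleRows K Kˢ (blockVec {n} {m} (λ _ → Xᴾ) (λ _ → 1ᴾ)) (λ i j → ≈-refl)) (*-congˡ (det K) (prod-blockVec n m Xᴾ))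

  Kˢ-ll : ∀ i j → Kˢ (i ↑ˡ m) (j ↑ˡ m) ≈ δ i j Xᴾ
  Kˢ-ll i j = ≈-trans (*-cong (topByλ.l i) (K.ll i j)) (≈-sym (δ-scale i j Xᴾ))
  Kˢ-lr : ∀ i q → Kˢ (i ↑ˡ m) (n ↑ʳ q) ≈ Xᴾ *ᴾ T i q
  Kˢ-lr i q = *-cong (topByλ.l i) (K.lr i q)
  Kˢ-rl : ∀ p j → Kˢ (n ↑ʳ p) (j ↑ˡ m) ≈ H p j
  Kˢ-rl p j = ≈-trans (*-cong (topByλ.r p) (K.rl p j)) (*-identityˡ _)
  Kˢ-rr : ∀ p q → Kˢ (n ↑ʳ p) (n ↑ʳ q) ≈ δ p q Xᴾ
  Kˢ-rr p q = ≈-trans (*-cong (topByλ.r p) (K.rr p q)) (*-identityˡ _)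

  Cᵀ : Mat (n ℕ.+ m)
  Cᵀ = blockMat O (λ i p → -ᴾ T i p) O O
  module Cᵀ = BlockEntries {n} {m} O (λ i p → -ᴾ T i p) O O

  Kᵀ : Mat (n ℕ.+ m)
  Kᵀ x y = Kˢ x y +ᴾ sumᴾ (λ k → Cᵀ x k *ᴾ Kˢ k y)

  det-Kᵀ : det Kᵀ ≈ det LT *ᴾ (Xᴾ ^ᴾ m)
  det-Kᵀ = ≈-trans (det-blockLowerTriangular n Kᵀ LT (λ p q → δ p q Xᴾ) top-left top-right bottom-right)
                   (*-congʳ (det LT) (det-scalar m Xᴾ))
    where
    top-left : ∀ i j → Kᵀ (i ↑ˡ m) (j ↑ˡ m) ≈ LT i j
    top-left i j = +-cong (Kˢ-ll i j)
      (≈-trans (row-times-column (Cᵀ (i ↑ˡ m)) Kˢ (j ↑ˡ m) (O i) (λ p → -ᴾ T i p) (Cᵀ.ll i) (Cᵀ.lr i))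
        (≈-trans (+-cong (sum-zeros n)
                         (sum-cong (λ p → ≈-trans (*-congʳ (-ᴾ T i p) (Kˢ-rl p j)) (neg-mul (T i p) (H p j)))))
                 (≈-sym (sum-neg (λ p → T i p *ᴾ H p j)))))
    top-right : ∀ i q → Kᵀ (i ↑ˡ m) (n ↑ʳ q) ≈ 0ᴾ
    top-right i q = ≈-trans (+-cong (Kˢ-lr i q)
      (≈-trans (row-times-column (Cᵀ (i ↑ˡ m)) Kˢ (n ↑ʳ q) (O i) (λ p → -ᴾ T i p) (Cᵀ.ll i) (Cᵀ.lr i))
        (+-cong (sum-zeros n)
                (≈-trans (sum-cong (λ p → *-congʳ (-ᴾ T i p) (Kˢ-rr p q))) (sum-δ (λ p → -ᴾ T i p) q Xᴾ)))))
      (cancel Xᴾ (T i q))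
      where
      cancel : ∀ x t → x *ᴾ t +ᴾ (0ᴾ +ᴾ (-ᴾ t) *ᴾ x) ≈ 0ᴾ
      cancel = solve-∀ ℤ[λ]-solver
    bottom-right : ∀ p q → Kᵀ (n ↑ʳ p) (n ↑ʳ q) ≈ δ p q Xᴾ
    bottom-right p q = ≈-trans (+-cong (Kˢ-rr p q)
      (≈-trans (row-times-column (Cᵀ (n ↑ʳ p)) Kˢ (n ↑ʳ q) (O p) (O p) (Cᵀ.rl p) (Cᵀ.rr p))
               (+-cong (sum-zeros n) (sum-zeros m))))
      (+-identityʳ _)

  sylvester : (Xᴾ ^ᴾ n) *ᴾ det LH ≈ (Xᴾ ^ᴾ m) *ᴾ det LT
  sylvester = begin
      (Xᴾ ^ᴾ n) *ᴾ det LH  ≈⟨ *-congʳ (Xᴾ ^ᴾ n) (≈-sym det-K) ⟩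
      (Xᴾ ^ᴾ n) *ᴾ det K   ≈⟨ ≈-sym det-Kˢ ⟩
      det Kˢ               ≈⟨ ≈-sym (det-addCombinations Kˢ Kᵀ Cᵀ (upperBlock-sources-fixed (λ i p → -ᴾ T i p)) (λ i j → ≈-refl)) ⟩
      det Kᵀ               ≈⟨ det-Kᵀ ⟩
      det LT *ᴾ (Xᴾ ^ᴾ m)  ≈⟨ *-comm (det LT) _ ⟩
      (Xᴾ ^ᴾ m) *ᴾ det LT  ∎
    where open ≈-Reasoning

-- Let A (n×n, n ≥ 1) and B (m×m) have all
-- column sums equal to c = λ − r, and let N = [[A, −J], [−J, B]] with J the
-- all-ones matrix.  Then  c²·det N = (c² − nm)·det A·det B.
--   * Scale the top rows of N by c and add all bottom rows to each top row:
--     the top-right block becomes −c·J + (column sums of B) = 0, giving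
--     cⁿ det N = det(cA − mJ)·det B.
--   * Adding all rows of an n×n matrix to its first row replaces that row by
--     the column sums; for cA − mJ and for cA these are the constants
--     c² − nm and c², and in both cases what remains after factoring is the
--     same matrix Z (first row 1, other rows those of cA, up to subtracting
--     m times the first row).  Hence det(cA − mJ)·c² = (c² − nm)·det(cA),
--     and det(cA) = cⁿ det A.
--   * Cancelling cⁿ (λ − r is not a zero divisor) gives the claim.
module BorderedBlock (r n' m : ℕ) (A : Mat (suc n')) (B : Mat m) (N : Mat (suc n' ℕ.+ m))
  (colsum-A : ∀ v → sumᴾ (λ u → A u v) ≈ linearFactor r)
  (colsum-B : ∀ q → sumᴾ (λ p → B p q) ≈ linearFactor r)
  (N-ll : ∀ i j → N (i ↑ˡ m) (j ↑ˡ m) ≈ A i j)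
  (N-lr : ∀ i q → N (i ↑ˡ m) (suc n' ↑ʳ q) ≈ -ᴾ 1ᴾ)
  (N-rl : ∀ p j → N (suc n' ↑ʳ p) (j ↑ˡ m) ≈ -ᴾ 1ᴾ)
  (N-rr : ∀ p q → N (suc n' ↑ʳ p) (suc n' ↑ʳ q) ≈ B p q) where

  n : ℕ
  n = suc n'
  c : Poly
  c = linearFactor r
  κ : Poly
  κ = c *ᴾ c -ᴾ constᴾ (+ n) *ᴾ constᴾ (+ m)

  Nᶜ : Mat (n ℕ.+ m)
  Nᶜ x y = blockVec {n} {m} (λ _ → c) (λ _ → 1ᴾ) x *ᴾ N x y
  module topByC = BlockVecEntries {n} {m} (λ _ → c) (λ _ → 1ᴾ)

  det-Nᶜ : det Nᶜ ≈ (c ^ᴾ n) *ᴾ det N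
  det-Nᶜ = ≈-trans (det-scaleRows N Nᶜ (blockVec {n} {m} (λ _ → c) (λ _ → 1ᴾ)) (λ i j → ≈-refl)) (*-congˡ (det N) (prod-blockVec n m c))

  Cᴶ : Mat (n ℕ.+ m)
  Cᴶ = blockMat {n} {m} O (λ _ _ → 1ᴾ) O O
  module Cᴶ = BlockEntries {n} {m} O (λ _ _ → 1ᴾ) O O

  Nʳ : Mat (n ℕ.+ m)
  Nʳ x y = Nᶜ x y +ᴾ sumᴾ (λ k → Cᴶ x k *ᴾ Nᶜ k y)

  A' : Mat n
  A' i j = c *ᴾ A i j -ᴾ constᴾ (+ m)

  det-Nʳ : det Nʳ ≈ det A' *ᴾ det B
  det-Nʳ = det-blockLowerTriangular n Nʳ A' B top-left top-right bottom-right
    where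
    bottom-sum : ∀ y → sumᴾ (λ p → 1ᴾ *ᴾ Nᶜ (n ↑ʳ p) y) ≈ sumᴾ (λ p → N (n ↑ʳ p) y)
    bottom-sum y = sum-cong (λ p → ≈-trans (*-identityˡ _) (≈-trans (*-congˡ (N (n ↑ʳ p) y) (topByC.r p)) (*-identityˡ _)))
    row-sum : ∀ i y → sumᴾ (λ k → Cᴶ (i ↑ˡ m) k *ᴾ Nᶜ k y) ≈ sumᴾ (λ p → N (n ↑ʳ p) y)
    row-sum i y = ≈-trans (row-times-column (Cᴶ (i ↑ˡ m)) Nᶜ y (O i) (λ _ → 1ᴾ) (Cᴶ.ll i) (Cᴶ.lr i))
                          (+-cong (sum-zeros n) (bottom-sum y))
    top-left : ∀ i j → Nʳ (i ↑ˡ m) (j ↑ˡ m) ≈ A' i j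
    top-left i j = +-cong (*-cong (topByC.l i) (N-ll i j))
      (≈-trans (row-sum i (j ↑ˡ m))
        (≈-trans (sum-cong (λ p → N-rl p j)) (≈-trans (sum-const m (-ᴾ 1ᴾ)) (mul-neg-one (constᴾ (+ m))))))
      where
      mul-neg-one : ∀ a → a *ᴾ (-ᴾ 1ᴾ) ≈ -ᴾ a
      mul-neg-one = solve-∀ ℤ[λ]-solver
    top-right : ∀ i q → Nʳ (i ↑ˡ m) (n ↑ʳ q) ≈ 0ᴾ
    top-right i q = ≈-trans (+-cong (*-cong (topByC.l i) (N-lr i q))
                                    (≈-trans (row-sum i (n ↑ʳ q)) (≈-trans (sum-cong (λ p → N-rr p q)) (colsum-B q))))
                            (cancel c)
      where
      cancel : ∀ c → c *ᴾ (-ᴾ 1ᴾ) +ᴾ c ≈ 0ᴾ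
      cancel = solve-∀ ℤ[λ]-solver
    bottom-right : ∀ p q → Nʳ (n ↑ʳ p) (n ↑ʳ q) ≈ B p q
    bottom-right p q = ≈-trans (+-cong (≈-trans (*-cong (topByC.r p) (N-rr p q)) (*-identityˡ _))
      (≈-trans (row-times-column (Cᴶ (n ↑ʳ p)) Nᶜ (n ↑ʳ q) (O p) (O p) (Cᴶ.rl p) (Cᴶ.rr p))
               (+-cong (sum-zeros n) (sum-zeros m))))
      (+-identityʳ _)

  det-Nʳ≈det-Nᶜ : det Nʳ ≈ det Nᶜ
  det-Nʳ≈det-Nᶜ = det-addCombinations Nᶜ Nʳ Cᴶ (upperBlock-sources-fixed {n} {m} (λ _ _ → 1ᴾ)) (λ i j → ≈-refl)

  others : Fin n → Poly
  others zero = 0ᴾ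
  others (suc _) = 1ᴾ

  addRowsToFirst : Mat n → Mat n
  addRowsToFirst M zero j = M zero j +ᴾ sumᴾ (λ k → others k *ᴾ M k j)
  addRowsToFirst M (suc i) j = M (suc i) j

  det-addRowsToFirst : ∀ M → det (addRowsToFirst M) ≈ det M
  det-addRowsToFirst M = det-addCombination M (addRowsToFirst M) zero others ≈-refl
    (λ { zero 0≢0 j → ⊥-elim (0≢0 refl) ; (suc k) _ j → ≈-refl }) (λ j → ≈-refl)

  addRowsToFirst-colsum : ∀ M j → addRowsToFirst M zero j ≈ sumᴾ (λ u → M u j)
  addRowsToFirst-colsum M j = +-cong (≈-refl {M zero j}) (sum-cong (λ k → *-identityˡ (M (suc k) j)))

  firstRowBy : Poly → Fin n → Poly
  firstRowBy a zero = a
  firstRowBy a (suc _) = 1ᴾ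

  prod-firstRowBy : ∀ a → prodᴾ (firstRowBy a) ≈ a
  prod-firstRowBy a = ≈-trans (*-congʳ a (prod-one n')) (*-identityʳ a)

  colsum-A' : ∀ j → sumᴾ (λ u → A' u j) ≈ κ
  colsum-A' j = begin
      sumᴾ (λ u → c *ᴾ A u j -ᴾ constᴾ (+ m))
    ≈⟨ sum-+ (λ u → c *ᴾ A u j) (λ u → -ᴾ constᴾ (+ m)) ⟩
      sumᴾ (λ u → c *ᴾ A u j) +ᴾ sumᴾ {n} (λ u → -ᴾ constᴾ (+ m))
    ≈⟨ +-cong (≈-trans (≈-sym (sum-*ˡ c (λ u → A u j))) (*-congʳ c (colsum-A j))) (sum-const n (-ᴾ constᴾ (+ m))) ⟩
      c *ᴾ c +ᴾ constᴾ (+ n) *ᴾ (-ᴾ constᴾ (+ m))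
    ≈⟨ ring c (constᴾ (+ n)) (constᴾ (+ m)) ⟩
      κ
    ∎
    where
    open ≈-Reasoning
    ring : ∀ c a b → c *ᴾ c +ᴾ a *ᴾ (-ᴾ b) ≈ c *ᴾ c -ᴾ a *ᴾ b
    ring = solve-∀ ℤ[λ]-solver

  cA : Mat n
  cA i j = c *ᴾ A i j

  Z : Mat n
  Z zero j = 1ᴾ
  Z (suc i) j = cA (suc i) j

  -- cA − mJ with its first row replaced by ones; it reduces to Z by adding
  -- m times the first row to the others
  Z' : Mat n
  Z' zero j = 1ᴾ
  Z' (suc i) j = A' (suc i) j

  det-Z' : det Z' ≈ det Z
  det-Z' = ≈-sym (det-addCombinations Z' Z coeffs sources-fixed Z-def)
    where
    coeffs : Fin n → Fin n → Poly
    coeffs (suc i) zero = constᴾ (+ m)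
    coeffs _ _ = 0ᴾ
    sources-fixed : ∀ i k → (coeffs i k ≈ 0ᴾ) ⊎ (∀ l → coeffs k l ≈ 0ᴾ)
    sources-fixed i zero = inj₂ (λ l → ≈-refl)
    sources-fixed zero (suc k) = inj₁ ≈-refl
    sources-fixed (suc i) (suc k) = inj₁ ≈-refl
    sub-add : ∀ a b → a -ᴾ b +ᴾ b ≈ a
    sub-add = solve-∀ ℤ[λ]-solver
    Z-def : ∀ i j → Z i j ≈ Z' i j +ᴾ sumᴾ (λ k → coeffs i k *ᴾ Z' k j)
    Z-def zero j = ≈-sym (+-cong (≈-refl {1ᴾ}) (sum-zeros n))
    Z-def (suc i) j = ≈-sym (≈-trans (+-cong (≈-refl {A' (suc i) j})
                                              (≈-trans (+-cong (*-identityʳ (constᴾ (+ m))) (sum-zeros n'))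
                                                       (+-identityʳ _)))
                                     (sub-add (cA (suc i) j) (constᴾ (+ m))))

  det-A' : det A' ≈ κ *ᴾ det Z
  det-A' = begin
      det A'                    ≈⟨ ≈-sym (det-addRowsToFirst A') ⟩
      det (addRowsToFirst A')   ≈⟨ det-scaleRows Z' (addRowsToFirst A') (firstRowBy κ) first-row-κ ⟩
      prodᴾ (firstRowBy κ) *ᴾ det Z' ≈⟨ *-cong (prod-firstRowBy κ) det-Z' ⟩
      κ *ᴾ det Z                ∎
    where
    open ≈-Reasoning
    first-row-κ : ∀ i j → addRowsToFirst A' i j ≈ firstRowBy κ i *ᴾ Z' i j
    first-row-κ zero j = ≈-trans (addRowsToFirst-colsum A' j) (≈-trans (colsum-A' j) (≈-sym (*-identityʳ κ)))
    first-row-κ (suc i) j = ≈-sym (*-identityˡ _)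

  -- det(cA) = c²·det Z, the column sums of cA being c²
  det-cA : det cA ≈ (c *ᴾ c) *ᴾ det Z
  det-cA = begin
      det cA                      ≈⟨ ≈-sym (det-addRowsToFirst cA) ⟩
      det (addRowsToFirst cA)     ≈⟨ det-scaleRows Z (addRowsToFirst cA) (firstRowBy (c *ᴾ c)) first-row-c² ⟩
      prodᴾ (firstRowBy (c *ᴾ c)) *ᴾ det Z ≈⟨ *-congˡ (det Z) (prod-firstRowBy (c *ᴾ c)) ⟩
      (c *ᴾ c) *ᴾ det Z           ∎
    where
    open ≈-Reasoning
    first-row-c² : ∀ i j → addRowsToFirst cA i j ≈ firstRowBy (c *ᴾ c) i *ᴾ Z i j
    first-row-c² zero j =
      ≈-trans (addRowsToFirst-colsum cA j)
              (≈-trans (≈-sym (sum-*ˡ c (λ u → A u j))) (≈-trans (*-congʳ c (colsum-A j)) (≈-sym (*-identityʳ (c *ᴾ c)))))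
    first-row-c² (suc i) j = ≈-sym (*-identityˡ _)

  bordered-det : c *ᴾ c *ᴾ det N ≈ κ *ᴾ det A *ᴾ det B
  bordered-det = linearFactor-pow-cancel r n _ _ (begin
      (c ^ᴾ n) *ᴾ (c *ᴾ c *ᴾ det N)    ≈⟨ swap-front (c ^ᴾ n) (c *ᴾ c) (det N) ⟩
      (c *ᴾ c) *ᴾ ((c ^ᴾ n) *ᴾ det N)  ≈⟨ *-congʳ (c *ᴾ c) (≈-trans (≈-sym det-Nᶜ) (≈-trans (≈-sym det-Nʳ≈det-Nᶜ) det-Nʳ)) ⟩
      (c *ᴾ c) *ᴾ (det A' *ᴾ det B)    ≈⟨ *-congʳ (c *ᴾ c) (*-congˡ (det B) det-A') ⟩
      (c *ᴾ c) *ᴾ ((κ *ᴾ det Z) *ᴾ det B) ≈⟨ regroup (c *ᴾ c) κ (det Z) (det B) ⟩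
      κ *ᴾ ((c *ᴾ c) *ᴾ det Z) *ᴾ det B ≈⟨ *-congˡ (det B) (*-congʳ κ (≈-trans (≈-sym det-cA) det-cA≈cⁿdetA)) ⟩
      κ *ᴾ ((c ^ᴾ n) *ᴾ det A) *ᴾ det B ≈⟨ pull-front κ (c ^ᴾ n) (det A) (det B) ⟩
      (c ^ᴾ n) *ᴾ (κ *ᴾ det A *ᴾ det B) ∎)
    where
    open ≈-Reasoning
    det-cA≈cⁿdetA : det cA ≈ (c ^ᴾ n) *ᴾ det A
    det-cA≈cⁿdetA = ≈-trans (det-scaleRows A cA (λ _ → c) (λ i j → ≈-refl)) (*-congˡ (det A) (prod-const n c))
    swap-front : ∀ a b d → a *ᴾ (b *ᴾ d) ≈ b *ᴾ (a *ᴾ d)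
    swap-front = solve-∀ ℤ[λ]-solver
    regroup : ∀ a k z b → a *ᴾ ((k *ᴾ z) *ᴾ b) ≈ k *ᴾ (a *ᴾ z) *ᴾ b
    regroup = solve-∀ ℤ[λ]-solver
    pull-front : ∀ k a d b → k *ᴾ (a *ᴾ d) *ᴾ b ≈ a *ᴾ (k *ᴾ d *ᴾ b)
    pull-front = solve-∀ ℤ[λ]-solver

InRegular : ∀ {n m} → ℕ → Digraph n m → Set
InRegular {n} r D = ∀ (v : Fin n) → count (λ e → ⌊ hd D e F.≟ v ⌋) ≡ r

charMat : ∀ {N} → (Fin N → Fin N → ℕ) → Mat N
charMat M i j = δ i j Xᴾ -ᴾ constᴾ (+ M i j)

colsum-char : ∀ {N K} (L : Fin N → Fin K → Poly) (R : Fin K → Fin N → Poly) v →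
  sumᴾ (λ u → δ u v Xᴾ -ᴾ sumᴾ (λ k → L u k *ᴾ R k v))
    ≈ Xᴾ -ᴾ sumᴾ (λ k → sumᴾ (λ u → L u k) *ᴾ R k v)
colsum-char L R v = ≈-trans (sum-+ (λ u → δ u v Xᴾ) (λ u → -ᴾ sumᴾ (λ k → L u k *ᴾ R k v)))
  (+-cong (sum-δ-column v Xᴾ)
    (≈-trans (≈-sym (sum-neg (λ u → sumᴾ (λ k → L u k *ᴾ R k v))))
      (neg-cong (≈-trans (sum-swap (λ u k → L u k *ᴾ R k v))
                         (sum-cong (λ k → ≈-sym (sum-*ʳ (R k v) (λ u → L u k))))))))

charMat-entry : ∀ {N} (M : Fin N → Fin N → ℕ) x y {d k} → δ x y Xᴾ ≈ d → M x y ≡ k →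
  charMat M x y ≈ d -ᴾ constᴾ (+ k)
charMat-entry M x y δ≈d refl = +-cong δ≈d ≈-refl

module Incidence {n m : ℕ} (D : Digraph n m) where

  T : Fin n → Fin m → Poly
  T u e = δ (tl D e) u 1ᴾ
  H : Fin m → Fin n → Poly
  H e v = δ (hd D e) v 1ᴾ

  open Sylvester n m T H public

  adj≈TH : ∀ u v → constᴾ (+ adj D u v) ≈ sumᴾ (λ e → T u e *ᴾ H e v)
  adj≈TH u v = ≈-trans (count-sum (λ e → if ⌊ tl D e F.≟ u ⌋ then ⌊ hd D e F.≟ v ⌋ else false))
                       (sum-cong (λ e → ind-and ⌊ tl D e F.≟ u ⌋ ⌊ hd D e F.≟ v ⌋))

  lineAdj≈HT : ∀ p q → constᴾ (+ lineAdj D p q) ≈ sumᴾ (λ v → H p v *ᴾ T v q)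
  lineAdj≈HT p q = ≈-sym (begin
      sumᴾ (λ v → δ (hd D p) v 1ᴾ *ᴾ T v q)  ≈⟨ sum-δˡ (λ v → T v q) (hd D p) 1ᴾ ⟩
      1ᴾ *ᴾ δ (tl D q) (hd D p) 1ᴾ           ≈⟨ *-identityˡ _ ⟩
      δ (tl D q) (hd D p) 1ᴾ                 ≈⟨ ≡⇒≈ (δ-sym (tl D q) (hd D p) 1ᴾ) ⟩
      ind ⌊ hd D p F.≟ tl D q ⌋              ≈⟨ ≈-sym (const-ind ⌊ hd D p F.≟ tl D q ⌋) ⟩
      constᴾ (+ lineAdj D p q)               ∎)
    where open ≈-Reasoning

  charMat-adj : ∀ u v → charMat (adj D) u v ≈ LT u v
  charMat-adj u v = +-cong ≈-refl (neg-cong (adj≈TH u v))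

  charMat-lineAdj : ∀ p q → charMat (lineAdj D) p q ≈ LH p q
  charMat-lineAdj p q = +-cong ≈-refl (neg-cong (lineAdj≈HT p q))

  module _ (r : ℕ) (regular : InRegular r D) where

    in-degree : ∀ v → sumᴾ (λ e → H e v) ≈ constᴾ (+ r)
    in-degree v = ≈-trans (≈-sym (count-sum (λ e → ⌊ hd D e F.≟ v ⌋)))
                          (≡⇒≈ (cong (λ k → constᴾ (+ k)) (regular v)))

    colsum-LT : ∀ v → sumᴾ (λ u → LT u v) ≈ linearFactor r
    colsum-LT v = ≈-trans (colsum-char T H v) (+-cong ≈-refl (neg-cong (begin
        sumᴾ (λ e → sumᴾ (λ u → T u e) *ᴾ H e v) ≈⟨ sum-cong (λ e → *-congˡ (H e v) (sum-δ-row (tl D e) 1ᴾ)) ⟩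
        sumᴾ (λ e → 1ᴾ *ᴾ H e v)                 ≈⟨ sum-cong (λ e → *-identityˡ (H e v)) ⟩
        sumᴾ (λ e → H e v)                       ≈⟨ in-degree v ⟩
        constᴾ (+ r)                             ∎)))
      where open ≈-Reasoning

    colsum-LH : ∀ q → sumᴾ (λ p → LH p q) ≈ linearFactor r
    colsum-LH q = ≈-trans (colsum-char H T q) (+-cong ≈-refl (neg-cong (begin
        sumᴾ (λ v → sumᴾ (λ p → H p v) *ᴾ T v q) ≈⟨ sum-cong (λ v → *-congˡ (T v q) (in-degree v)) ⟩
        sumᴾ (λ v → constᴾ (+ r) *ᴾ T v q)      ≈⟨ ≈-sym (sum-*ˡ (constᴾ (+ r)) (λ v → T v q)) ⟩
        constᴾ (+ r) *ᴾ sumᴾ (λ v → T v q)      ≈⟨ *-congʳ (constᴾ (+ r)) (sum-δ-row (tl D q) 1ᴾ) ⟩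
        constᴾ (+ r) *ᴾ 1ᴾ                      ≈⟨ *-identityʳ _ ⟩
        constᴾ (+ r)                            ∎)))
      where open ≈-Reasoning

  plusAdj-ll : ∀ i j → plusAdj D (i ↑ˡ m) (j ↑ˡ m) ≡ adj D i j
  plusAdj-ll i j rewrite FP.splitAt-↑ˡ n i m | FP.splitAt-↑ˡ n j m = refl
  plusAdj-lr : ∀ i q → plusAdj D (i ↑ˡ m) (n ↑ʳ q) ≡ 1
  plusAdj-lr i q rewrite FP.splitAt-↑ˡ n i m | FP.splitAt-↑ʳ n m q = refl
  plusAdj-rl : ∀ p j → plusAdj D (n ↑ʳ p) (j ↑ˡ m) ≡ 1
  plusAdj-rl p j rewrite FP.splitAt-↑ʳ n m p | FP.splitAt-↑ˡ n j m = refl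
  plusAdj-rr : ∀ p q → plusAdj D (n ↑ʳ p) (n ↑ʳ q) ≡ lineAdj D p q
  plusAdj-rr p q rewrite FP.splitAt-↑ʳ n m p | FP.splitAt-↑ʳ n m q = refl

  charMat-plus-ll : ∀ i j → charMat (plusAdj D) (i ↑ˡ m) (j ↑ˡ m) ≈ LT i j
  charMat-plus-ll i j = ≈-trans (charMat-entry (plusAdj D) _ _ (δ-ll {n} {m} i j Xᴾ) (plusAdj-ll i j)) (charMat-adj i j)
  charMat-plus-lr : ∀ i q → charMat (plusAdj D) (i ↑ˡ m) (n ↑ʳ q) ≈ -ᴾ 1ᴾ
  charMat-plus-lr i q = charMat-entry (plusAdj D) _ _ (δ-lr {n} {m} i q Xᴾ) (plusAdj-lr i q)
  charMat-plus-rl : ∀ p j → charMat (plusAdj D) (n ↑ʳ p) (j ↑ˡ m) ≈ -ᴾ 1ᴾ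
  charMat-plus-rl p j = charMat-entry (plusAdj D) _ _ (δ-rl {n} {m} j p Xᴾ) (plusAdj-rl p j)
  charMat-plus-rr : ∀ p q → charMat (plusAdj D) (n ↑ʳ p) (n ↑ʳ q) ≈ LH p q
  charMat-plus-rr p q = ≈-trans (charMat-entry (plusAdj D) _ _ (δ-rr {n} {m} p q Xᴾ) (plusAdj-rr p q)) (charMat-lineAdj p q)

theorem4p10 : (n m r : ℕ) (D : Digraph n m) → 1 ≤ n → Regular r D →
    (Xᴾ ^ᴾ n) *ᴾ ((Xᴾ -ᴾ constᴾ (+ r)) ^ᴾ 2) *ᴾ charPoly (plusAdj D)
    ≈ᴾ (Xᴾ ^ᴾ m) *ᴾ (((Xᴾ -ᴾ constᴾ (+ r)) ^ᴾ 2) -ᴾ constᴾ (+ (m * n)))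
    *ᴾ (charPoly (adj D) ^ᴾ 2)
theorem4p10 (suc n') m r D (s≤s _) regular = get (begin
    (Xᴾ ^ᴾ n) *ᴾ (c *ᴾ (c *ᴾ 1ᴾ)) *ᴾ det N  ≈⟨ *-congˡ (det N) (*-congʳ (Xᴾ ^ᴾ n) (*-congʳ c (*-identityʳ c))) ⟩
    (Xᴾ ^ᴾ n) *ᴾ (c *ᴾ c) *ᴾ det N         ≈⟨ *-assoc (Xᴾ ^ᴾ n) (c *ᴾ c) (det N) ⟩
    (Xᴾ ^ᴾ n) *ᴾ (c *ᴾ c *ᴾ det N)         ≈⟨ *-congʳ (Xᴾ ^ᴾ n) bordered-det ⟩
    (Xᴾ ^ᴾ n) *ᴾ (κ *ᴾ det LT *ᴾ det LH)   ≈⟨ move-λⁿ (Xᴾ ^ᴾ n) κ (det LT) (det LH) ⟩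
    κ *ᴾ det LT *ᴾ ((Xᴾ ^ᴾ n) *ᴾ det LH)   ≈⟨ *-congʳ (κ *ᴾ det LT) sylvester ⟩
    κ *ᴾ det LT *ᴾ ((Xᴾ ^ᴾ m) *ᴾ det LT)   ≈⟨ collect κ (det LT) (Xᴾ ^ᴾ m) ⟩
    (Xᴾ ^ᴾ m) *ᴾ κ *ᴾ (det LT *ᴾ (det LT *ᴾ 1ᴾ))
      ≈⟨ *-cong (*-congʳ (Xᴾ ^ᴾ m) κ≈c²-mn) (≈-sym (*-cong charPoly≈det-LT (*-congˡ 1ᴾ charPoly≈det-LT))) ⟩
    (Xᴾ ^ᴾ m) *ᴾ ((c ^ᴾ 2) -ᴾ constᴾ (+ (m * n))) *ᴾ (charPoly (adj D) ^ᴾ 2) ∎)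
  where
  open ≈-Reasoning
  n : ℕ
  n = suc n'
  c : Poly
  c = linearFactor r
  N : Mat (n ℕ.+ m)
  N = charMat (plusAdj D)
  open Incidence D
  open BorderedBlock r n' m LT LH N (colsum-LT r (λ v → proj₂ (regular v))) (colsum-LH r (λ v → proj₂ (regular v)))
                     charMat-plus-ll charMat-plus-lr charMat-plus-rl charMat-plus-rr
    using (κ; bordered-det)
  charPoly≈det-LT : charPoly (adj D) ≈ det LT
  charPoly≈det-LT = det-cong charMat-adj
  κ≈c²-mn : κ ≈ (c ^ᴾ 2) -ᴾ constᴾ (+ (m * n))
  κ≈c²-mn = +-cong (*-congʳ c (≈-sym (*-identityʳ c)))
                   (neg-cong (≈-trans (≈-sym (const-* n m)) (≡⇒≈ (cong (λ k → constᴾ (+ k)) (ℕP.*-comm n m)))))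
  move-λⁿ : ∀ x k a b → x *ᴾ (k *ᴾ a *ᴾ b) ≈ k *ᴾ a *ᴾ (x *ᴾ b)
  move-λⁿ = solve-∀ ℤ[λ]-solver
  collect : ∀ k a y → k *ᴾ a *ᴾ (y *ᴾ a) ≈ y *ᴾ k *ᴾ (a *ᴾ (a *ᴾ 1ᴾ))
  collect = solve-∀ ℤ[λ]-solver
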